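{- Let $k$ be a positive integer and let $\mathcal{L}_k$ be the set of all $L_k$-overpartitions. Then \[ \sum_{\pi\in\mathcal{L}_k}z^{\ell_o(\pi)}q^{|\pi|}=1+\sum_{s=1}^k\sum_{m=1}^\infty\sum_{j=1}^m(z^{j-1}+z^j)\frac{q^{k\binom{j}{2}+sj+k(m-j)}}{(q;q)_{k(m-1)+s}}{m-1\brack j-1}_k. \]
   Context: An overpartition (in the "last occurrence" convention) is a partition $\pi=(\pi_1,\ldots,\pi_\ell)$, written in non-increasing order, in which the last occurrence of each distinct part value may be overlined (so among parts of equal size the overlined one, if any, is the last). $|\pi|$ is the sum of the parts (overlined $\overline t$ counting as $t$) and $\ell_o(\pi)$ is the number of overlined parts. An $L_k$-overpartition is such an overpartition $\pi=(\pi_1,\ldots,\pi_\ell)$ with the additional property that whenever $\pi_i$ is overlined, $\ell-i\equiv 0\pmod k$. The empty overpartition is included. Notation: $(a;q)_n=\prod_{i=0}^{n-1}(1-aq^i)$; for nonnegative integers $A,B$, ${A\brack B}_k=\frac{(q^k;q^k)_A}{(q^k;q^k)_B(q^k;q^k)_{A-B}}$ if $A\ge B\ge 0$ and $0$ otherwise. -}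

module Defs where

open import Data.Nat as ℕ using (ℕ; zero; suc; _+_; _*_; _∸_; _≤_; _<_; _≡ᵇ_; _≤ᵇ_)
open import Data.Nat.Divisibility using (_∣_; _∣?_)
open import Data.Nat.Combinatorics using (_C_)
open import Data.Integer as ℤ using (ℤ; +_)
open import Data.Bool using (Bool; true; false; if_then_else_; _∧_)
open import Data.Product using (_×_; proj₁; proj₂)
open import Data.List using (List; []; _∷_; length; lookup; map)
open import Data.Nat.ListAction using (sum)
open import Data.Fin as Fin using (Fin; toℕ)
open import Relation.Nullary using (¬_)
open import Relation.Nullary.Decidable using (⌊_⌋)
open import Relation.Binary.PropositionalEquality using (_≡_)

-- Overpartitions (last-occurrence convention)
-- A part is (value , overlined?). The list is π₁ , π₂ , … , π_ℓ.

Part : Set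
Part = ℕ × Bool

OverPtn : Set
OverPtn = List Part

val : Part → ℕ
val = proj₁

over : Part → Bool
over = proj₂

IsOverpartition : OverPtn → Set
IsOverpartition π =
  (∀ (i : Fin (length π)) → 0 < val (lookup π i)) ×
  (∀ (i j : Fin (length π)) → i Fin.< j → val (lookup π j) ≤ val (lookup π i)) ×
  (∀ (i j : Fin (length π)) → i Fin.< j → over (lookup π i) ≡ true →
      ¬ (val (lookup π j) ≡ val (lookup π i)))

-- L_k condition: if π_i (1-based index i = toℕ i' + 1) is overlined then k ∣ ℓ - i.
IsLkOverpartition : ℕ → OverPtn → Set
IsLkOverpartition k π =
  IsOverpartition π ×
  (∀ (i : Fin (length π)) → over (lookup π i) ≡ true →
      k ∣ (length π ∸ suc (toℕ i)))

size : OverPtn → ℕ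
size π = sum (map val π)

numOver : OverPtn → ℕ
numOver π = sum (map (λ p → if over p then 1 else 0) π)

-- Formal power series in q with integer coefficients: coefficient functions.

Series : Set
Series = ℕ → ℤ

sumℤ : ℕ → (ℕ → ℤ) → ℤ
sumℤ zero    f = + 0
sumℤ (suc n) f = sumℤ n f ℤ.+ f n

ind : Bool → ℤ
ind b = if b then + 1 else + 0

_⊛_ : Series → Series → Series
(f ⊛ g) n = sumℤ (suc n) (λ i → f i ℤ.* g (n ∸ i))

oneS : Series
oneS n = ind (n ≡ᵇ 0)

zeroS : Series
zeroS n = + 0

qPow : ℕ → Series
qPow e n = ind (n ≡ᵇ e)

oneMinus : ℕ → Series
oneMinus e n = ind (n ≡ᵇ 0) ℤ.- ind (n ≡ᵇ e)

-- 1/(1 - q^e) = Σ_{m≥0} q^{e m}   (used only for e ≥ 1)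
geomInv : ℕ → Series
geomInv e n = ind ⌊ e ∣? n ⌋

prodS : ℕ → (ℕ → Series) → Series
prodS zero    F = oneS
prodS (suc N) F = prodS N F ⊛ F N

qPoch : ℕ → ℕ → Series
qPoch k N = prodS N (λ i → oneMinus (k * suc i))

qPochInv : ℕ → ℕ → Series
qPochInv k N = prodS N (λ i → geomInv (k * suc i))

qBin : ℕ → ℕ → ℕ → Series
qBin k A B = if B ≤ᵇ A
  then (qPoch k A ⊛ qPochInv k B) ⊛ qPochInv k (A ∸ B)
  else zeroS

-- The (m,j,s)-term has q-valuation ≥ s j + k(m-j) ≥ m (as k,s ≥ 1),
-- so only m ≤ n contribute to the coefficient of q^n; the m-sum is
-- therefore truncated at m = n exactly.

rhsTerm : ℕ → ℕ → ℕ → ℕ → Series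
rhsTerm k s m j =
  (qPow (k * (j C 2) + s * j + k * (m ∸ j)) ⊛ qPochInv 1 (k * (m ∸ 1) + s))
    ⊛ qBin k (m ∸ 1) (j ∸ 1)

zCoeff : ℕ → ℕ → ℤ
zCoeff j t = ind (t ≡ᵇ (j ∸ 1)) ℤ.+ ind (t ≡ᵇ j)

rhsCoeff : ℕ → ℕ → ℕ → ℤ
rhsCoeff k n t =
  ind ((n ≡ᵇ 0) ∧ (t ≡ᵇ 0)) ℤ.+
  sumℤ k (λ s' → sumℤ n (λ m' → sumℤ (suc m') (λ j' →
     zCoeff (suc j') t ℤ.* rhsTerm k (suc s') (suc m') (suc j') n)))

-- An overpartition π₁ ≥ ⋯ ≥ π_ℓ is encoded by its differences d_i = π_i − π_{i+1} (with
-- d_ℓ = π_ℓ ≥ 1): its size is Σ i d_i, and an overlined π_i needs d_i ≥ 1. For an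
-- L_k-overpartition of length ℓ = k(m − 1) + s, 1 ≤ s ≤ k, position i may be overlined iff
-- i ≡ s (mod k). A position that cannot be overlined contributes 1/(1 − q^i), one that can
-- contributes (1 + z q^i)/(1 − q^i), and the last one contributes (1 + z) q^ℓ/(1 − q^ℓ); the
-- overlinable positions below ℓ are s, s + k, …, s + k(m − 2), so the length-ℓ part of the
-- generating function is (1 + z) q^ℓ/(q;q)_ℓ · ∏_{j<m−1} (1 + z q^(s+kj)), and the q-binomial
-- theorem, proved from the q-Pascal rule, expands the product into the sum over j. The
-- L_k-overpartitions of n with t overlined parts are listed by extending difference lists one
-- position at a time, which turns each extension step into a product with 1/(1 − q^i).

module Submission where

open import Defs
open import Data.Nat using (ℕ; suc; _≤_)
open import Data.Integer using (+_)
open import Data.List using (List; length)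
open import Data.List.Relation.Unary.Unique.Propositional using (Unique)
open import Data.List.Membership.Propositional using (_∈_)
open import Data.Product using (Σ; _×_; _,_)
open import Function.Bundles using (_⇔_; mk⇔)
open import Relation.Binary.PropositionalEquality using (_≡_)

module PowerSeries where

  open import Data.Nat as ℕ using (ℕ; zero; suc; _∸_; _≡ᵇ_; z≤n; s≤s)
  import Data.Nat.Properties as ℕ
  open import Data.Nat.Divisibility using (_∣?_; ∣m+n∣m⇒∣n; ∣m∣n⇒∣m+n; ∣⇒≤; n∣n)
  open import Data.Integer using (ℤ; +_; _+_; _*_; -_; _-_)
  import Data.Integer.Properties as ℤ
  open import Data.Integer.Tactic.RingSolver using (solve-∀)
  open import Data.Bool using (Bool; true; false; not; _∧_)
  open import Data.Product using (_,_)
  open import Data.Sum using (inj₁; inj₂)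
  open import Function using (_∘_)
  open import Relation.Nullary using (yes; no; contradiction)
  open import Relation.Nullary.Decidable using (⌊_⌋; dec-false; isYes≗does)
  open import Relation.Binary.Bundles using (Setoid)
  open import Relation.Binary.PropositionalEquality using (_≡_; _≢_; refl; sym; trans; cong; cong₂; module ≡-Reasoning)
  open import Algebra.Bundles using (CommutativeMonoid)
  import Algebra.Solver.CommutativeMonoid

  infix 4 _≈_
  _≈_ : Series → Series → Set
  f ≈ g = ∀ n → f n ≡ g n

  infixl 6 _⊕_
  _⊕_ : Series → Series → Series
  (f ⊕ g) n = f n + g n

  scale : ℤ → Series → Series
  scale c f n = c * f n

  tail : Series → Series
  tail f n = f (suc n)

  ≈-setoid : Setoid _ _
  ≈-setoid = record
    { Carrier = Series ; _≈_ = _≈_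
    ; isEquivalence = record
      { refl = λ _ → refl ; sym = λ p n → sym (p n) ; trans = λ p q n → trans (p n) (q n) } }

  open Setoid ≈-setoid public using () renaming (refl to ≈-refl; sym to ≈-sym; trans to ≈-trans)

  ≡⇒≈ : ∀ {f g} → f ≡ g → f ≈ g
  ≡⇒≈ refl _ = refl

  sumℤ-cong : ∀ N {F G : ℕ → ℤ} → (∀ i → i ℕ.< N → F i ≡ G i) → sumℤ N F ≡ sumℤ N G
  sumℤ-cong zero    p = refl
  sumℤ-cong (suc N) p = cong₂ _+_ (sumℤ-cong N (λ i i<N → p i (ℕ.m<n⇒m<1+n i<N))) (p N ℕ.≤-refl)

  sumℤ-suc : ∀ N (F : ℕ → ℤ) → sumℤ (suc N) F ≡ F 0 + sumℤ N (λ i → F (suc i))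
  sumℤ-suc zero    F = trans (ℤ.+-identityˡ (F 0)) (sym (ℤ.+-identityʳ (F 0)))
  sumℤ-suc (suc N) F = begin
    sumℤ (suc N) F + F (suc N)                   ≡⟨ cong (_+ F (suc N)) (sumℤ-suc N F) ⟩
    F 0 + sumℤ N (λ i → F (suc i)) + F (suc N)   ≡⟨ ℤ.+-assoc (F 0) _ _ ⟩
    F 0 + sumℤ (suc N) (λ i → F (suc i))         ∎
    where open ≡-Reasoning

  sumℤ-+ : ∀ N (F G : ℕ → ℤ) → sumℤ N (λ i → F i + G i) ≡ sumℤ N F + sumℤ N G
  sumℤ-+ zero    F G = refl
  sumℤ-+ (suc N) F G = trans (cong (_+ (F N + G N)) (sumℤ-+ N F G)) (interchange (sumℤ N F) (sumℤ N G) (F N) (G N))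
    where
    interchange : ∀ a b c d → a + b + (c + d) ≡ a + c + (b + d)
    interchange = solve-∀

  *-sumℤ : ∀ N c (F : ℕ → ℤ) → c * sumℤ N F ≡ sumℤ N (λ i → c * F i)
  *-sumℤ zero    c F = ℤ.*-zeroʳ c
  *-sumℤ (suc N) c F = trans (ℤ.*-distribˡ-+ c (sumℤ N F) (F N)) (cong (_+ c * F N) (*-sumℤ N c F))

  sumℤ-zero : ∀ N (F : ℕ → ℤ) → (∀ i → F i ≡ + 0) → sumℤ N F ≡ + 0
  sumℤ-zero zero    F p = refl
  sumℤ-zero (suc N) F p = cong₂ _+_ (sumℤ-zero N F p) (p N)

  sumℤ-reverse : ∀ N (F : ℕ → ℤ) → sumℤ N F ≡ sumℤ N (λ i → F (N ∸ suc i))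
  sumℤ-reverse zero    F = refl
  sumℤ-reverse (suc N) F = begin
    sumℤ N F + F N                          ≡⟨ ℤ.+-comm (sumℤ N F) (F N) ⟩
    F N + sumℤ N F                          ≡⟨ cong (λ x → F N + x) (sumℤ-reverse N F) ⟩
    F N + sumℤ N (λ i → F (N ∸ suc i))      ≡⟨ sym (sumℤ-suc N (λ i → F (N ∸ i))) ⟩
    sumℤ (suc N) (λ i → F (N ∸ i))          ∎
    where open ≡-Reasoning

  ≢⇒≡ᵇ-false : ∀ {m n} → m ≢ n → (m ≡ᵇ n) ≡ false
  ≢⇒≡ᵇ-false {zero}  {zero}  0≢0 = contradiction refl 0≢0
  ≢⇒≡ᵇ-false {zero}  {suc n} _   = refl
  ≢⇒≡ᵇ-false {suc m} {zero}  _   = refl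
  ≢⇒≡ᵇ-false {suc m} {suc n} m≢n = ≢⇒≡ᵇ-false (λ m≡n → m≢n (cong suc m≡n))

  ≡ᵇ-refl : ∀ n → (n ≡ᵇ n) ≡ true
  ≡ᵇ-refl zero    = refl
  ≡ᵇ-refl (suc n) = ≡ᵇ-refl n

  sumℤ-select-≥ : ∀ N t (F : ℕ → ℤ) → N ℕ.≤ t → sumℤ N (λ j → ind (t ≡ᵇ j) * F j) ≡ + 0
  sumℤ-select-≥ N t F N≤t = trans (sumℤ-cong N vanish) (sumℤ-zero N (λ _ → + 0) (λ _ → refl))
    where
    vanish : ∀ j → j ℕ.< N → ind (t ≡ᵇ j) * F j ≡ + 0
    vanish j j<N = trans (cong (λ b → ind b * F j) (≢⇒≡ᵇ-false (ℕ.>⇒≢ (ℕ.<-≤-trans j<N N≤t)))) (ℤ.*-zeroˡ (F j))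

  sumℤ-select-< : ∀ N t (F : ℕ → ℤ) → t ℕ.< N → sumℤ N (λ j → ind (t ≡ᵇ j) * F j) ≡ F t
  sumℤ-select-< (suc N) t F t<1+N with ℕ.m≤n⇒m<n∨m≡n (ℕ.≤-pred t<1+N)
  ... | inj₁ t<N = begin
    sumℤ N (λ j → ind (t ≡ᵇ j) * F j) + ind (t ≡ᵇ N) * F N
      ≡⟨ cong₂ _+_ (sumℤ-select-< N t F t<N) (cong (λ b → ind b * F N) (≢⇒≡ᵇ-false (ℕ.<⇒≢ t<N))) ⟩
    F t + + 0 * F N   ≡⟨ cong (λ x → F t + x) (ℤ.*-zeroˡ (F N)) ⟩
    F t + + 0         ≡⟨ ℤ.+-identityʳ (F t) ⟩
    F t               ∎
    where open ≡-Reasoning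
  ... | inj₂ refl = begin
    sumℤ t (λ j → ind (t ≡ᵇ j) * F j) + ind (t ≡ᵇ t) * F t
      ≡⟨ cong₂ _+_ (sumℤ-select-≥ t t F ℕ.≤-refl) (cong (λ b → ind b * F t) (≡ᵇ-refl t)) ⟩
    + 0 + + 1 * F t   ≡⟨ ℤ.+-identityˡ _ ⟩
    + 1 * F t         ≡⟨ ℤ.*-identityˡ (F t) ⟩
    F t               ∎
    where open ≡-Reasoning

  sumℤ-select : ∀ N t (F : ℕ → ℤ) → (∀ j → N ℕ.≤ j → F j ≡ + 0) → sumℤ N (λ j → ind (t ≡ᵇ j) * F j) ≡ F t
  sumℤ-select N t F vanish with ℕ.<-≤-connex t N
  ... | inj₁ t<N = sumℤ-select-< N t F t<N
  ... | inj₂ N≤t = trans (sumℤ-select-≥ N t F N≤t) (sym (vanish t N≤t))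

  ⊛-zero : ∀ f g → (f ⊛ g) 0 ≡ f 0 * g 0
  ⊛-zero f g = ℤ.+-identityˡ _

  ⊛-suc : ∀ f g n → (f ⊛ g) (suc n) ≡ f 0 * g (suc n) + (tail f ⊛ g) n
  ⊛-suc f g n = sumℤ-suc (suc n) (λ i → f i * g (suc n ∸ i))

  ⊛-cong : ∀ {f f′ g g′} → f ≈ f′ → g ≈ g′ → f ⊛ g ≈ f′ ⊛ g′
  ⊛-cong p q n = sumℤ-cong (suc n) (λ i _ → cong₂ _*_ (p i) (q (n ∸ i)))

  ⊛-congˡ : ∀ {f f′} g → f ≈ f′ → f ⊛ g ≈ f′ ⊛ g
  ⊛-congˡ g p = ⊛-cong p (≈-refl {g})

  ⊛-congʳ : ∀ f {g g′} → g ≈ g′ → f ⊛ g ≈ f ⊛ g′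
  ⊛-congʳ f p = ⊛-cong (≈-refl {f}) p

  ⊕-cong : ∀ {f f′ g g′} → f ≈ f′ → g ≈ g′ → f ⊕ g ≈ f′ ⊕ g′
  ⊕-cong p q n = cong₂ _+_ (p n) (q n)

  ⊕-identityˡ : ∀ f → zeroS ⊕ f ≈ f
  ⊕-identityˡ f n = ℤ.+-identityˡ (f n)

  ⊕-identityʳ : ∀ f → f ⊕ zeroS ≈ f
  ⊕-identityʳ f n = ℤ.+-identityʳ (f n)

  ⊛-comm : ∀ f g → f ⊛ g ≈ g ⊛ f
  ⊛-comm f g n = begin
    sumℤ (suc n) (λ i → f i * g (n ∸ i))                ≡⟨ sumℤ-reverse (suc n) _ ⟩
    sumℤ (suc n) (λ i → f (n ∸ i) * g (n ∸ (n ∸ i)))    ≡⟨ sumℤ-cong (suc n) swap ⟩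
    sumℤ (suc n) (λ i → g i * f (n ∸ i))                ∎
    where
    open ≡-Reasoning
    swap : ∀ i → i ℕ.< suc n → f (n ∸ i) * g (n ∸ (n ∸ i)) ≡ g i * f (n ∸ i)
    swap i i<1+n = trans (ℤ.*-comm (f (n ∸ i)) _)
      (cong (λ j → g j * f (n ∸ i)) (ℕ.m∸[m∸n]≡n (ℕ.≤-pred i<1+n)))

  ⊛-zeroˡ : ∀ f g → (∀ i → f i ≡ + 0) → f ⊛ g ≈ zeroS
  ⊛-zeroˡ f g p n = sumℤ-zero (suc n) _ (λ i → cong (_* g (n ∸ i)) (p i))

  ⊛-zeroʳ : ∀ f → f ⊛ zeroS ≈ zeroS
  ⊛-zeroʳ f n = trans (⊛-comm f zeroS n) (⊛-zeroˡ zeroS f (λ _ → refl) n)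

  ⊛-distribˡ-⊕ : ∀ f g h → f ⊛ (g ⊕ h) ≈ (f ⊛ g) ⊕ (f ⊛ h)
  ⊛-distribˡ-⊕ f g h n =
    trans (sumℤ-cong (suc n) (λ i _ → ℤ.*-distribˡ-+ (f i) _ _)) (sumℤ-+ (suc n) _ _)

  ⊛-distribʳ-⊕ : ∀ f g h → (f ⊕ g) ⊛ h ≈ (f ⊛ h) ⊕ (g ⊛ h)
  ⊛-distribʳ-⊕ f g h n =
    trans (sumℤ-cong (suc n) (λ i _ → ℤ.*-distribʳ-+ (h (n ∸ i)) (f i) _)) (sumℤ-+ (suc n) _ _)

  scale-⊛ : ∀ c f g → scale c f ⊛ g ≈ scale c (f ⊛ g)
  scale-⊛ c f g n = trans (sumℤ-cong (suc n) (λ i _ → ℤ.*-assoc c (f i) _)) (sym (*-sumℤ (suc n) c _))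

  ⊛-assoc : ∀ f g h → (f ⊛ g) ⊛ h ≈ f ⊛ (g ⊛ h)
  ⊛-assoc f g h zero = begin
    ((f ⊛ g) ⊛ h) 0       ≡⟨ ⊛-zero (f ⊛ g) h ⟩
    (f ⊛ g) 0 * h 0       ≡⟨ cong (_* h 0) (⊛-zero f g) ⟩
    f 0 * g 0 * h 0       ≡⟨ ℤ.*-assoc (f 0) _ _ ⟩
    f 0 * (g 0 * h 0)     ≡⟨ cong (f 0 *_) (sym (⊛-zero g h)) ⟩
    f 0 * (g ⊛ h) 0       ≡⟨ sym (⊛-zero f (g ⊛ h)) ⟩
    (f ⊛ (g ⊛ h)) 0       ∎
    where open ≡-Reasoning
  ⊛-assoc f g h (suc n) = begin
    ((f ⊛ g) ⊛ h) (suc n)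
      ≡⟨ ⊛-suc (f ⊛ g) h n ⟩
    (f ⊛ g) 0 * h (suc n) + (tail (f ⊛ g) ⊛ h) n
      ≡⟨ cong₂ _+_ (cong (_* h (suc n)) (⊛-zero f g)) (⊛-congˡ h (⊛-suc f g) n) ⟩
    f 0 * g 0 * h (suc n) + ((scale (f 0) (tail g) ⊕ (tail f ⊛ g)) ⊛ h) n
      ≡⟨ cong (λ x → f 0 * g 0 * h (suc n) + x) (⊛-distribʳ-⊕ (scale (f 0) (tail g)) (tail f ⊛ g) h n) ⟩
    f 0 * g 0 * h (suc n) + ((scale (f 0) (tail g) ⊛ h) n + ((tail f ⊛ g) ⊛ h) n)
      ≡⟨ cong₂ (λ a b → f 0 * g 0 * h (suc n) + (a + b)) (scale-⊛ (f 0) (tail g) h n) (⊛-assoc (tail f) g h n) ⟩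
    f 0 * g 0 * h (suc n) + (f 0 * (tail g ⊛ h) n + (tail f ⊛ (g ⊛ h)) n)
      ≡⟨ regroup (f 0) (g 0) (h (suc n)) _ _ ⟩
    f 0 * (g 0 * h (suc n) + (tail g ⊛ h) n) + (tail f ⊛ (g ⊛ h)) n
      ≡⟨ cong (λ a → f 0 * a + (tail f ⊛ (g ⊛ h)) n) (sym (⊛-suc g h n)) ⟩
    f 0 * (g ⊛ h) (suc n) + (tail f ⊛ (g ⊛ h)) n
      ≡⟨ sym (⊛-suc f (g ⊛ h) n) ⟩
    (f ⊛ (g ⊛ h)) (suc n) ∎
    where
    open ≡-Reasoning
    regroup : ∀ a b c d e → a * b * c + (a * d + e) ≡ a * (b * c + d) + e
    regroup = solve-∀

  ⊛-identityˡ : ∀ f → oneS ⊛ f ≈ f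
  ⊛-identityˡ f zero    = trans (⊛-zero oneS f) (ℤ.*-identityˡ (f 0))
  ⊛-identityˡ f (suc n) = begin
    (oneS ⊛ f) (suc n)                          ≡⟨ ⊛-suc oneS f n ⟩
    + 1 * f (suc n) + (tail oneS ⊛ f) n
      ≡⟨ cong₂ _+_ (ℤ.*-identityˡ (f (suc n))) (⊛-zeroˡ (tail oneS) f (λ _ → refl) n) ⟩
    f (suc n) + + 0                             ≡⟨ ℤ.+-identityʳ _ ⟩
    f (suc n)                                   ∎
    where open ≡-Reasoning

  ⊛-identityʳ : ∀ f → f ⊛ oneS ≈ f
  ⊛-identityʳ f = ≈-trans (⊛-comm f oneS) (⊛-identityˡ f)

  open import Relation.Binary.Reasoning.Setoid ≈-setoid

  ⊛-commutativeMonoid : CommutativeMonoid _ _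
  ⊛-commutativeMonoid = record
    { Carrier = Series ; _≈_ = _≈_ ; _∙_ = _⊛_ ; ε = oneS
    ; isCommutativeMonoid = record
      { isMonoid = record
        { isSemigroup = record
          { isMagma = record { isEquivalence = Setoid.isEquivalence ≈-setoid ; ∙-cong = ⊛-cong }
          ; assoc = ⊛-assoc }
        ; identity = ⊛-identityˡ , ⊛-identityʳ }
      ; comm = ⊛-comm } }

  data Offset (e : ℕ) : ℕ → Set where
    below : ∀ {n} → n ℕ.< e → Offset e n
    above : ∀ m → Offset e (e ℕ.+ m)

  offset : ∀ e n → Offset e n
  offset zero    n       = above n
  offset (suc e) zero    = below (s≤s z≤n)
  offset (suc e) (suc n) with offset e n
  ... | below n<e = below (s≤s n<e)
  ... | above m   = above m

  shift : ℕ → Series → Series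
  shift zero    f n       = f n
  shift (suc e) f zero    = + 0
  shift (suc e) f (suc n) = shift e f n

  shift-below : ∀ e f {n} → n ℕ.< e → shift e f n ≡ + 0
  shift-below (suc e) f {zero}  _         = refl
  shift-below (suc e) f {suc n} (s≤s n<e) = shift-below e f n<e

  shift-above : ∀ e f m → shift e f (e ℕ.+ m) ≡ f m
  shift-above zero    f m = refl
  shift-above (suc e) f m = shift-above e f m

  qPow-⊛ : ∀ e f → qPow e ⊛ f ≈ shift e f
  qPow-⊛ zero    f         = ⊛-identityˡ f
  qPow-⊛ (suc e) f zero    = trans (⊛-zero (qPow (suc e)) f) (ℤ.*-zeroˡ (f 0))
  qPow-⊛ (suc e) f (suc n) = trans (⊛-suc (qPow (suc e)) f n)
    (trans (cong₂ _+_ (ℤ.*-zeroˡ (f (suc n))) (qPow-⊛ e f n)) (ℤ.+-identityˡ _))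

  shift-qPow : ∀ a b → shift a (qPow b) ≈ qPow (a ℕ.+ b)
  shift-qPow zero    b n       = refl
  shift-qPow (suc a) b zero    = refl
  shift-qPow (suc a) b (suc n) = shift-qPow a b n

  qPow-+ : ∀ a b → qPow (a ℕ.+ b) ≈ qPow a ⊛ qPow b
  qPow-+ a b = ≈-sym (≈-trans (qPow-⊛ a (qPow b)) (shift-qPow a b))

  positiveMultiple : ℕ → ℕ → Bool
  positiveMultiple e r = not (r ≡ᵇ 0) ∧ ⌊ e ∣? r ⌋

  ∣?-+ : ∀ e m → ⌊ e ∣? (e ℕ.+ m) ⌋ ≡ ⌊ e ∣? m ⌋
  ∣?-+ e m with e ∣? (e ℕ.+ m) | e ∣? m
  ... | yes _ | yes _ = refl
  ... | no  _ | no  _ = refl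
  ... | yes p | no ¬q = contradiction (∣m+n∣m⇒∣n p n∣n) ¬q
  ... | no ¬p | yes q = contradiction (∣m∣n⇒∣m+n n∣n q) ¬p

  qPow-⊛-geomInv : ∀ e → qPow (suc e) ⊛ geomInv (suc e) ≈ ind ∘ positiveMultiple (suc e)
  qPow-⊛-geomInv e r = trans (qPow-⊛ (suc e) (geomInv (suc e)) r) (shifted (offset (suc e) r))
    where
    shifted : ∀ {r} → Offset (suc e) r → shift (suc e) (geomInv (suc e)) r ≡ ind (positiveMultiple (suc e) r)
    shifted {zero}  (below _)   = refl
    shifted {suc r} (below r<e) = trans (shift-below (suc e) (geomInv (suc e)) r<e)
      (cong ind (sym (trans (isYes≗does (suc e ∣? suc r)) (dec-false (suc e ∣? suc r) (λ e∣r → ℕ.<⇒≱ r<e (∣⇒≤ e∣r))))))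
    shifted (above m) = trans (shift-above (suc e) (geomInv (suc e)) m) (cong ind (sym (∣?-+ (suc e) m)))

  oneMinus-⊛-geomInv : ∀ e → oneMinus (suc e) ⊛ geomInv (suc e) ≈ oneS
  oneMinus-⊛-geomInv e = begin
    oneMinus (suc e) ⊛ G                         ≈⟨ ⊛-congˡ G (λ n → cong (λ x → ind (n ≡ᵇ 0) + x) (sym (ℤ.-1*i≡-i _))) ⟩
    (oneS ⊕ scale (- + 1) (qPow (suc e))) ⊛ G    ≈⟨ ⊛-distribʳ-⊕ oneS _ G ⟩
    (oneS ⊛ G) ⊕ (scale (- + 1) (qPow (suc e)) ⊛ G)
      ≈⟨ ⊕-cong (⊛-identityˡ G) (≈-trans (scale-⊛ (- + 1) (qPow (suc e)) G)
                                          (λ n → cong (- + 1 *_) (qPow-⊛-geomInv e n))) ⟩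
    G ⊕ scale (- + 1) (ind ∘ positiveMultiple (suc e))   ≈⟨ cancel ⟩
    oneS                                         ∎
    where
    G = geomInv (suc e)
    x-x≡0 : ∀ x → x + - + 1 * x ≡ + 0
    x-x≡0 = solve-∀
    cancel : G ⊕ scale (- + 1) (ind ∘ positiveMultiple (suc e)) ≈ oneS
    cancel zero    = refl
    cancel (suc n) = x-x≡0 (G (suc n))

  +-≡ᵇ-+ : ∀ a m b → (a ℕ.+ m ≡ᵇ a ℕ.+ b) ≡ (m ≡ᵇ b)
  +-≡ᵇ-+ zero    m b = refl
  +-≡ᵇ-+ (suc a) m b = +-≡ᵇ-+ a m b

  +-≡ᵇ-identityʳ : ∀ a m → (a ℕ.+ m ≡ᵇ a) ≡ (m ≡ᵇ 0)
  +-≡ᵇ-identityʳ zero    m = refl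
  +-≡ᵇ-identityʳ (suc a) m = +-≡ᵇ-identityʳ a m

  oneMinus-+ : ∀ a b → oneMinus (a ℕ.+ b) ≈ oneMinus a ⊕ (qPow a ⊛ oneMinus b)
  oneMinus-+ a b n = trans (split (offset a n)) (cong (λ x → oneMinus a n + x) (sym (qPow-⊛ a (oneMinus b) n)))
    where
    split : ∀ {n} → Offset a n → oneMinus (a ℕ.+ b) n ≡ oneMinus a n + shift a (oneMinus b) n
    split {n} (below n<a)
      rewrite shift-below a (oneMinus b) n<a
            | ≢⇒≡ᵇ-false (ℕ.<⇒≢ (ℕ.<-≤-trans n<a (ℕ.m≤m+n a b)))
            | ≢⇒≡ᵇ-false (ℕ.<⇒≢ n<a) = sym (ℤ.+-identityʳ _)
    split (above m)
      rewrite shift-above a (oneMinus b) m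
            | +-≡ᵇ-+ a m b
            | +-≡ᵇ-identityʳ a m = telescope (ind (a ℕ.+ m ≡ᵇ 0)) (ind (m ≡ᵇ b)) (ind (m ≡ᵇ 0))
      where
      telescope : ∀ x y z → x - y ≡ x - z + (z - y)
      telescope = solve-∀

  module ⊛-Solver = Algebra.Solver.CommutativeMonoid ⊛-commutativeMonoid

  cancelʳ : ∀ f a b → a ⊛ b ≈ oneS → f ⊛ (a ⊛ b) ≈ f
  cancelʳ f a b ab≈1 = ≈-trans (⊛-congʳ f ab≈1) (⊛-identityʳ f)

open PowerSeries

module QBinomial (k′ : ℕ) where

  open import Data.Nat as ℕ using (ℕ; zero; suc; _+_; _*_; _∸_; _≤ᵇ_; s≤s)
  import Data.Nat.Properties as ℕ
  open import Data.Nat.Combinatorics using (_C_; nCk+nC[k+1]≡[n+1]C[k+1]; nC1≡n)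
  import Data.Nat.Tactic.RingSolver as ℕ-Solver
  open import Data.Bool using (true; false)
  open import Data.Unit using (tt)
  open import Relation.Binary.Definitions using (Tri; tri<; tri≈; tri>)
  open import Data.Sum using ([_,_]′)
  open import Relation.Nullary using (contradiction)
  open import Relation.Binary.PropositionalEquality using (_≡_; refl; sym; trans; cong; cong₂)
  open import Relation.Binary.Reasoning.Setoid ≈-setoid
  open ⊛-Solver using (solve; _⊜_) renaming (_⊕_ to _∙_)

  k : ℕ
  k = suc k′

  factor factorInv : ℕ → Series
  factor    i = oneMinus (k * suc i)
  factorInv i = geomInv (k * suc i)

  factor-⊛-factorInv : ∀ i → factor i ⊛ factorInv i ≈ oneS
  factor-⊛-factorInv i = oneMinus-⊛-geomInv (i + k′ * suc i)

  qPoch-⊛-qPochInv : ∀ A → qPoch k A ⊛ qPochInv k A ≈ oneS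
  qPoch-⊛-qPochInv zero    = ⊛-identityˡ oneS
  qPoch-⊛-qPochInv (suc A) = begin
    (qPoch k A ⊛ factor A) ⊛ (qPochInv k A ⊛ factorInv A)
      ≈⟨ solve 4 (λ a b c d → (a ∙ b) ∙ (c ∙ d) ⊜ (a ∙ c) ∙ (b ∙ d)) (λ _ → refl)
           (qPoch k A) (factor A) (qPochInv k A) (factorInv A) ⟩
    (qPoch k A ⊛ qPochInv k A) ⊛ (factor A ⊛ factorInv A)
      ≈⟨ ⊛-cong (qPoch-⊛-qPochInv A) (factor-⊛-factorInv A) ⟩
    oneS ⊛ oneS
      ≈⟨ ⊛-identityˡ oneS ⟩
    oneS ∎

  qBin-≤ : ∀ {M t} → t ℕ.≤ M → qBin k M t ≡ (qPoch k M ⊛ qPochInv k t) ⊛ qPochInv k (M ∸ t)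
  qBin-≤ {M} {t} t≤M with t ≤ᵇ M | ℕ.≤⇒≤ᵇ t≤M
  ... | true | _ = refl

  qBin-> : ∀ {M t} → M ℕ.< t → qBin k M t ≡ zeroS
  qBin-> {M} {t} M<t with t ≤ᵇ M | ℕ.≤ᵇ⇒≤ t M
  ... | false | _   = refl
  ... | true  | t≤M = contradiction (t≤M tt) (ℕ.<⇒≱ M<t)

  qBin-zero : ∀ M → qBin k M 0 ≈ oneS
  qBin-zero M = ≈-trans (⊛-congˡ (qPochInv k M) (⊛-identityʳ (qPoch k M))) (qPoch-⊛-qPochInv M)

  qBin-diag : ∀ M → qBin k M M ≈ oneS
  qBin-diag M = begin
    qBin k M M                                      ≡⟨ qBin-≤ (ℕ.≤-refl {M}) ⟩
    (qPoch k M ⊛ qPochInv k M) ⊛ qPochInv k (M ∸ M) ≡⟨ cong (λ d → (qPoch k M ⊛ qPochInv k M) ⊛ qPochInv k d) (ℕ.n∸n≡0 M) ⟩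
    (qPoch k M ⊛ qPochInv k M) ⊛ oneS               ≈⟨ ⊛-identityʳ (qPoch k M ⊛ qPochInv k M) ⟩
    qPoch k M ⊛ qPochInv k M                        ≈⟨ qPoch-⊛-qPochInv M ⟩
    oneS                                            ∎

  -- With D = M ∸ (t + 1), the rule comes from splitting the top factor of (q^k;q^k)_(M+1) as
  -- 1 - q^(k(M+1)) = (1 - q^(k(D+1))) + q^(k(D+1)) (1 - q^(k(t+1))).
  qBin-pascal-< : ∀ {M t} → t ℕ.< M →
    qBin k (suc M) (suc t) ≈ qBin k M (suc t) ⊕ (qPow (k * (M ∸ t)) ⊛ qBin k M t)
  qBin-pascal-< {suc M} {t} (s≤s t≤M) = begin
    qBin k (2 + M) (suc t)                              ≈⟨ expand ⟩
    X ⊛ factor (suc M)                                  ≈⟨ ⊛-congʳ X factor-split ⟩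
    X ⊛ (factor D ⊕ (qPow (k * suc D) ⊛ factor t))      ≈⟨ ⊛-distribˡ-⊕ X (factor D) (qPow (k * suc D) ⊛ factor t) ⟩
    (X ⊛ factor D) ⊕ (X ⊛ (qPow (k * suc D) ⊛ factor t))
      ≈⟨ ⊕-cong lower (≈-trans (swap X (qPow (k * suc D)) (factor t)) (⊛-congʳ (qPow (k * suc D)) upper)) ⟩
    qBin k (suc M) (suc t) ⊕ (qPow (k * suc D) ⊛ qBin k (suc M) t)
      ≡⟨ cong (λ d → qBin k (suc M) (suc t) ⊕ (qPow (k * d) ⊛ qBin k (suc M) t)) (sym 1+M∸t≡1+D) ⟩
    qBin k (suc M) (suc t) ⊕ (qPow (k * (suc M ∸ t)) ⊛ qBin k (suc M) t) ∎
    where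
    D = M ∸ t
    1+M∸t≡1+D : suc M ∸ t ≡ suc D
    1+M∸t≡1+D = ℕ.+-∸-assoc 1 t≤M
    2+D+t≡2+M : suc D + suc t ≡ suc (suc M)
    2+D+t≡2+M = cong suc (trans (ℕ.+-suc D t) (cong suc (ℕ.m∸n+n≡m t≤M)))
    P  = qPoch k (suc M)
    X  = ((P ⊛ qPochInv k t) ⊛ qPochInv k D) ⊛ (factorInv t ⊛ factorInv D)
    swap : ∀ a b c → a ⊛ (b ⊛ c) ≈ b ⊛ (a ⊛ c)
    swap = solve 3 (λ a b c → a ∙ (b ∙ c) ⊜ b ∙ (a ∙ c)) (λ _ → refl)
    factor-split : factor (suc M) ≈ factor D ⊕ (qPow (k * suc D) ⊛ factor t)
    factor-split = begin
      oneMinus (k * suc (suc M))               ≡⟨ cong (λ x → oneMinus (k * x)) (sym 2+D+t≡2+M) ⟩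
      oneMinus (k * (suc D + suc t))           ≡⟨ cong oneMinus (ℕ.*-distribˡ-+ k (suc D) (suc t)) ⟩
      oneMinus (k * suc D + k * suc t)         ≈⟨ oneMinus-+ (k * suc D) (k * suc t) ⟩
      factor D ⊕ (qPow (k * suc D) ⊛ factor t) ∎
    Jt = qPochInv k t
    JD = qPochInv k D
    expand : qBin k (2 + M) (suc t) ≈ X ⊛ factor (suc M)
    expand = begin
      qBin k (2 + M) (suc t)
        ≡⟨ qBin-≤ (s≤s (ℕ.m≤n⇒m≤1+n t≤M)) ⟩
      ((P ⊛ factor (suc M)) ⊛ (Jt ⊛ factorInv t)) ⊛ qPochInv k (suc M ∸ t)
        ≡⟨ cong (λ d → ((P ⊛ factor (suc M)) ⊛ (Jt ⊛ factorInv t)) ⊛ qPochInv k d) 1+M∸t≡1+D ⟩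
      ((P ⊛ factor (suc M)) ⊛ (Jt ⊛ factorInv t)) ⊛ (JD ⊛ factorInv D)
        ≈⟨ solve 6 (λ p f jt gt jd gd → ((p ∙ f) ∙ (jt ∙ gt)) ∙ (jd ∙ gd) ⊜ (((p ∙ jt) ∙ jd) ∙ (gt ∙ gd)) ∙ f)
             (λ _ → refl) P (factor (suc M)) Jt (factorInv t) JD (factorInv D) ⟩
      X ⊛ factor (suc M) ∎
    lower : X ⊛ factor D ≈ qBin k (suc M) (suc t)
    lower = begin
      X ⊛ factor D
        ≈⟨ solve 6 (λ p jt jd gt gd f → (((p ∙ jt) ∙ jd) ∙ (gt ∙ gd)) ∙ f ⊜ ((p ∙ (jt ∙ gt)) ∙ jd) ∙ (f ∙ gd))
             (λ _ → refl) P Jt JD (factorInv t) (factorInv D) (factor D) ⟩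
      ((P ⊛ (Jt ⊛ factorInv t)) ⊛ JD) ⊛ (factor D ⊛ factorInv D)
        ≈⟨ cancelʳ ((P ⊛ (Jt ⊛ factorInv t)) ⊛ JD) (factor D) (factorInv D) (factor-⊛-factorInv D) ⟩
      (P ⊛ (Jt ⊛ factorInv t)) ⊛ JD
        ≡⟨ qBin-≤ (s≤s t≤M) ⟨
      qBin k (suc M) (suc t) ∎
    upper : X ⊛ factor t ≈ qBin k (suc M) t
    upper = begin
      X ⊛ factor t
        ≈⟨ solve 6 (λ p jt jd gt gd f → (((p ∙ jt) ∙ jd) ∙ (gt ∙ gd)) ∙ f ⊜ ((p ∙ jt) ∙ (jd ∙ gd)) ∙ (f ∙ gt))
             (λ _ → refl) P Jt JD (factorInv t) (factorInv D) (factor t) ⟩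
      ((P ⊛ Jt) ⊛ (JD ⊛ factorInv D)) ⊛ (factor t ⊛ factorInv t)
        ≈⟨ cancelʳ ((P ⊛ Jt) ⊛ (JD ⊛ factorInv D)) (factor t) (factorInv t) (factor-⊛-factorInv t) ⟩
      (P ⊛ Jt) ⊛ qPochInv k (suc D)
        ≡⟨ cong (λ d → (P ⊛ Jt) ⊛ qPochInv k d) 1+M∸t≡1+D ⟨
      (P ⊛ Jt) ⊛ qPochInv k (suc M ∸ t)
        ≡⟨ qBin-≤ (ℕ.m≤n⇒m≤1+n t≤M) ⟨
      qBin k (suc M) t ∎

  qBin-pascal-≡ : ∀ {M t} → t ≡ M →
    qBin k (suc M) (suc t) ≈ qBin k M (suc t) ⊕ (qPow (k * (M ∸ t)) ⊛ qBin k M t)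
  qBin-pascal-≡ {M} refl = begin
    qBin k (suc M) (suc M)                              ≈⟨ qBin-diag (suc M) ⟩
    oneS                                                ≈⟨ ⊛-identityˡ oneS ⟨
    qPow 0 ⊛ oneS                                       ≈⟨ ⊛-cong (≡⇒≈ (cong qPow k*[M∸M]≡0)) (qBin-diag M) ⟨
    qPow (k * (M ∸ M)) ⊛ qBin k M M                     ≈⟨ ⊕-identityˡ _ ⟨
    zeroS ⊕ (qPow (k * (M ∸ M)) ⊛ qBin k M M)           ≡⟨ cong (_⊕ (qPow (k * (M ∸ M)) ⊛ qBin k M M)) (qBin-> (ℕ.n<1+n M)) ⟨
    qBin k M (suc M) ⊕ (qPow (k * (M ∸ M)) ⊛ qBin k M M) ∎
    where
    k*[M∸M]≡0 : k * (M ∸ M) ≡ 0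
    k*[M∸M]≡0 = trans (cong (k *_) (ℕ.n∸n≡0 M)) (ℕ.*-zeroʳ k)

  qBin-pascal-> : ∀ {M t} → M ℕ.< t →
    qBin k (suc M) (suc t) ≈ qBin k M (suc t) ⊕ (qPow (k * (M ∸ t)) ⊛ qBin k M t)
  qBin-pascal-> {M} {t} M<t = begin
    qBin k (suc M) (suc t)                              ≡⟨ qBin-> (s≤s M<t) ⟩
    zeroS                                               ≈⟨ ⊛-zeroʳ (qPow (k * (M ∸ t))) ⟨
    qPow (k * (M ∸ t)) ⊛ zeroS                          ≈⟨ ⊕-identityˡ _ ⟨
    zeroS ⊕ (qPow (k * (M ∸ t)) ⊛ zeroS)                ≡⟨ cong (λ b → zeroS ⊕ (qPow (k * (M ∸ t)) ⊛ b)) (qBin-> M<t) ⟨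
    zeroS ⊕ (qPow (k * (M ∸ t)) ⊛ qBin k M t)
      ≡⟨ cong (_⊕ (qPow (k * (M ∸ t)) ⊛ qBin k M t)) (qBin-> (ℕ.m<n⇒m<1+n M<t)) ⟨
    qBin k M (suc t) ⊕ (qPow (k * (M ∸ t)) ⊛ qBin k M t) ∎

  qBin-pascal : ∀ M t → qBin k (suc M) (suc t) ≈ qBin k M (suc t) ⊕ (qPow (k * (M ∸ t)) ⊛ qBin k M t)
  qBin-pascal M t = byCases (ℕ.<-cmp t M)
    where
    byCases : Tri (t ℕ.< M) (t ≡ M) (M ℕ.< t) →
              qBin k (suc M) (suc t) ≈ qBin k M (suc t) ⊕ (qPow (k * (M ∸ t)) ⊛ qBin k M t)
    byCases (tri< t<M _ _) = qBin-pascal-< t<M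
    byCases (tri≈ _ t≡M _) = qBin-pascal-≡ t≡M
    byCases (tri> _ _ M<t) = qBin-pascal-> M<t

  -- the coefficient of z^t in ∏_{j<M} (1 + z q^(s+kj)), by the q-binomial theorem
  binomialTerm : ℕ → ℕ → ℕ → Series
  binomialTerm s M t = qPow (k * (t C 2) + s * t) ⊛ qBin k M t

  binomialTerm-zero : ∀ s M → binomialTerm s M 0 ≈ oneS
  binomialTerm-zero s M = begin
    qPow (k * 0 + s * 0) ⊛ qBin k M 0   ≡⟨ cong (λ e → qPow e ⊛ qBin k M 0) (cong₂ _+_ (ℕ.*-zeroʳ k) (ℕ.*-zeroʳ s)) ⟩
    oneS ⊛ qBin k M 0                   ≈⟨ ⊛-identityˡ (qBin k M 0) ⟩
    qBin k M 0                          ≈⟨ qBin-zero M ⟩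
    oneS                                ∎

  binomialTerm-> : ∀ s {M t} → M ℕ.< t → binomialTerm s M t ≈ zeroS
  binomialTerm-> s {M} {t} M<t = begin
    qPow (k * (t C 2) + s * t) ⊛ qBin k M t   ≡⟨ cong (qPow (k * (t C 2) + s * t) ⊛_) (qBin-> M<t) ⟩
    qPow (k * (t C 2) + s * t) ⊛ zeroS        ≈⟨ ⊛-zeroʳ (qPow (k * (t C 2) + s * t)) ⟩
    zeroS                                     ∎

  exponent-suc : ∀ s {M t} → t ℕ.≤ M →
    k * (suc t C 2) + s * suc t + k * (M ∸ t) ≡ s + k * M + (k * (t C 2) + s * t)
  exponent-suc s {M} {t} t≤M =
    trans (cong (λ c → k * c + s * suc t + k * (M ∸ t)) 1+tC2)
    (trans (regroup k s t (t C 2) (M ∸ t))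
           (cong (λ m → s + k * m + (k * (t C 2) + s * t)) (ℕ.m+[n∸m]≡n t≤M)))
    where
    1+tC2 : suc t C 2 ≡ t + t C 2
    1+tC2 = trans (sym (nCk+nC[k+1]≡[n+1]C[k+1] t 1)) (cong (_+ t C 2) (nC1≡n t))
    regroup : ∀ k s t c d → k * (t + c) + s * suc t + k * d ≡ s + k * (t + d) + (k * c + s * t)
    regroup = ℕ-Solver.solve-∀

  binomialTerm-suc-≤ : ∀ s {M t} → t ℕ.≤ M →
    binomialTerm s (suc M) (suc t) ≈ binomialTerm s M (suc t) ⊕ (qPow (s + k * M) ⊛ binomialTerm s M t)
  binomialTerm-suc-≤ s {M} {t} t≤M = begin
    qPow e₁ ⊛ qBin k (suc M) (suc t)
      ≈⟨ ⊛-congʳ (qPow e₁) (qBin-pascal M t) ⟩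
    qPow e₁ ⊛ (qBin k M (suc t) ⊕ (qPow (k * (M ∸ t)) ⊛ qBin k M t))
      ≈⟨ ⊛-distribˡ-⊕ (qPow e₁) (qBin k M (suc t)) (qPow (k * (M ∸ t)) ⊛ qBin k M t) ⟩
    binomialTerm s M (suc t) ⊕ (qPow e₁ ⊛ (qPow (k * (M ∸ t)) ⊛ qBin k M t))
      ≈⟨ ⊕-cong (≈-refl {binomialTerm s M (suc t)}) (≈-sym (⊛-assoc (qPow e₁) (qPow (k * (M ∸ t))) (qBin k M t))) ⟩
    binomialTerm s M (suc t) ⊕ ((qPow e₁ ⊛ qPow (k * (M ∸ t))) ⊛ qBin k M t)
      ≈⟨ ⊕-cong (≈-refl {binomialTerm s M (suc t)}) (⊛-congˡ (qBin k M t) (≈-sym (qPow-+ e₁ (k * (M ∸ t))))) ⟩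
    binomialTerm s M (suc t) ⊕ (qPow (e₁ + k * (M ∸ t)) ⊛ qBin k M t)
      ≡⟨ cong (λ e → binomialTerm s M (suc t) ⊕ (qPow e ⊛ qBin k M t)) (exponent-suc s t≤M) ⟩
    binomialTerm s M (suc t) ⊕ (qPow (s + k * M + e₀) ⊛ qBin k M t)
      ≈⟨ ⊕-cong (≈-refl {binomialTerm s M (suc t)}) (≈-trans (⊛-congˡ (qBin k M t) (qPow-+ (s + k * M) e₀))
                                                                      (⊛-assoc (qPow (s + k * M)) (qPow e₀) (qBin k M t))) ⟩
    binomialTerm s M (suc t) ⊕ (qPow (s + k * M) ⊛ binomialTerm s M t) ∎
    where
    e₁ = k * (suc t C 2) + s * suc t
    e₀ = k * (t C 2) + s * t

  binomialTerm-suc-> : ∀ s {M t} → M ℕ.< t →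
    binomialTerm s (suc M) (suc t) ≈ binomialTerm s M (suc t) ⊕ (qPow (s + k * M) ⊛ binomialTerm s M t)
  binomialTerm-suc-> s {M} {t} M<t = begin
    binomialTerm s (suc M) (suc t)
      ≈⟨ binomialTerm-> s (s≤s M<t) ⟩
    zeroS
      ≈⟨ ⊕-cong (binomialTerm-> s (ℕ.m<n⇒m<1+n M<t))
                (≈-trans (⊛-congʳ (qPow (s + k * M)) (binomialTerm-> s M<t)) (⊛-zeroʳ (qPow (s + k * M)))) ⟨
    binomialTerm s M (suc t) ⊕ (qPow (s + k * M) ⊛ binomialTerm s M t) ∎

  binomialTerm-suc : ∀ s M t →
    binomialTerm s (suc M) (suc t) ≈ binomialTerm s M (suc t) ⊕ (qPow (s + k * M) ⊛ binomialTerm s M t)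
  binomialTerm-suc s M t = [ binomialTerm-suc-≤ s , binomialTerm-suc-> s ]′ (ℕ.≤-<-connex t M)

module DifferenceLists where

  open import Data.Nat as ℕ using (ℕ; suc; _+_; _*_; _≤_; z≤n)
  import Data.Nat.Properties as ℕ
  import Data.Nat.Tactic.RingSolver as ℕ-Solver
  open import Data.Bool using (Bool; true; false; if_then_else_)
  open import Data.Product using (_×_; _,_; proj₁; proj₂)
  open import Data.List using (List; []; _∷_; length; lookup; _∷ʳ_)
  import Data.List.Properties as List
  open import Relation.Binary.PropositionalEquality using (_≡_; refl; sym; trans; cong; cong₂; subst)

  Diffs : Set
  Diffs = List (ℕ × Bool)

  total : Diffs → ℕ
  total []            = 0
  total ((d , _) ∷ D) = d + total D

  -- (d₁ , f₁) ∷ ⋯ ∷ (d_ℓ , f_ℓ) encodes the parts π_i = d_i + ⋯ + d_ℓ, with π_i overlined iff f_i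
  toParts : Diffs → OverPtn
  toParts []            = []
  toParts ((d , f) ∷ D) = (d + total D , f) ∷ toParts D

  weight : Diffs → ℕ
  weight D = size (toParts D)

  overlines : Diffs → ℕ
  overlines D = numOver (toParts D)

  lastDiff : Diffs → ℕ
  lastDiff []          = 0
  lastDiff (x ∷ [])    = proj₁ x
  lastDiff (_ ∷ y ∷ D) = lastDiff (y ∷ D)

  bit : Bool → ℕ
  bit f = if f then 1 else 0

  length-∷ʳ : ∀ (D : Diffs) x → length (D ∷ʳ x) ≡ suc (length D)
  length-∷ʳ D x = trans (List.length-++ D) (ℕ.+-comm (length D) 1)

  length-toParts : ∀ D → length (toParts D) ≡ length D
  length-toParts []            = refl
  length-toParts ((d , f) ∷ D) = cong suc (length-toParts D)

  total-∷ʳ : ∀ D c f → total (D ∷ʳ (c , f)) ≡ total D + c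
  total-∷ʳ []            c f = ℕ.+-identityʳ c
  total-∷ʳ ((d , _) ∷ D) c f = trans (cong (λ x → d + x) (total-∷ʳ D c f)) (sym (ℕ.+-assoc d _ c))

  -- appending c at position ℓ + 1 raises every one of the ℓ + 1 parts by c
  weight-∷ʳ : ∀ D c f → weight (D ∷ʳ (c , f)) ≡ weight D + suc (length D) * c
  weight-∷ʳ []            c f = regroup c
    where
    regroup : ∀ c → c + 0 + 0 ≡ 0 + 1 * c
    regroup = ℕ-Solver.solve-∀
  weight-∷ʳ ((d , _) ∷ D) c f rewrite total-∷ʳ D c f | weight-∷ʳ D c f =
    regroup d (total D) c (weight D) (length D)
    where
    regroup : ∀ d s c w ℓ → d + (s + c) + (w + suc ℓ * c) ≡ d + s + w + suc (suc ℓ) * c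
    regroup = ℕ-Solver.solve-∀

  overlines-∷ʳ : ∀ D c f → overlines (D ∷ʳ (c , f)) ≡ overlines D + bit f
  overlines-∷ʳ []            c false = refl
  overlines-∷ʳ []            c true  = refl
  overlines-∷ʳ ((_ , g) ∷ D) c f rewrite overlines-∷ʳ D c f = sym (ℕ.+-assoc (bit g) (overlines D) (bit f))

  lastDiff-∷ʳ : ∀ (D : Diffs) x → lastDiff (D ∷ʳ x) ≡ proj₁ x
  lastDiff-∷ʳ []          x = refl
  lastDiff-∷ʳ (_ ∷ [])    x = refl
  lastDiff-∷ʳ (_ ∷ y ∷ D) x = lastDiff-∷ʳ (y ∷ D) x

  lastDiff≤total : ∀ D → lastDiff D ≤ total D
  lastDiff≤total []                = z≤n
  lastDiff≤total ((d , _) ∷ [])    = ℕ.m≤m+n d 0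
  lastDiff≤total ((d , _) ∷ y ∷ D) = ℕ.≤-trans (lastDiff≤total (y ∷ D)) (ℕ.m≤n+m _ d)

  toParts-injective : ∀ D₁ D₂ → toParts D₁ ≡ toParts D₂ → D₁ ≡ D₂
  toParts-injective []                []                _  = refl
  toParts-injective ((d₁ , f₁) ∷ D₁) ((d₂ , f₂) ∷ D₂) eq with List.∷-injective eq
  ... | head≡ , tail≡ with toParts-injective D₁ D₂ tail≡
  ... | refl = cong (_∷ D₁) (cong₂ _,_ (ℕ.+-cancelʳ-≡ (total D₁) d₁ d₂ (cong proj₁ head≡)) (cong proj₂ head≡))

  module _ (k : ℕ) where

    open import Data.Nat using (_<_; _∸_; s≤s)
    open import Data.Nat.Divisibility using (_∣_)
    open import Data.Unit using (⊤; tt)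
    open import Data.Fin as Fin using (Fin; toℕ) renaming (zero to fzero; suc to fsuc)
    open import Relation.Nullary using (¬_)

    -- a counts the entries that are still to be appended after D
    Admissible : ℕ → Diffs → Set
    Admissible a []            = ⊤
    Admissible a ((d , f) ∷ D) = (f ≡ true → 1 ≤ d × k ∣ length D + a) × Admissible a D

    length-∷ʳ-+ : ∀ (D : Diffs) x a → length (D ∷ʳ x) + a ≡ length D + suc a
    length-∷ʳ-+ D x a = trans (cong (_+ a) (length-∷ʳ D x)) (sym (ℕ.+-suc (length D) a))

    Admissible-∷ʳ⁻ : ∀ a D c f → Admissible a (D ∷ʳ (c , f)) →
                     Admissible (suc a) D × (f ≡ true → 1 ≤ c × k ∣ a)
    Admissible-∷ʳ⁻ a []            c f (last , _) = tt , last
    Admissible-∷ʳ⁻ a ((d , g) ∷ D) c f (head , rest) with Admissible-∷ʳ⁻ a D c f rest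
    ... | restᵃ , last =
      ((λ g≡t → proj₁ (head g≡t) , subst (k ∣_) (length-∷ʳ-+ D (c , f) a) (proj₂ (head g≡t))) , restᵃ) , last

    Admissible-∷ʳ⁺ : ∀ a D c f → Admissible (suc a) D → (f ≡ true → 1 ≤ c × k ∣ a) →
                     Admissible a (D ∷ʳ (c , f))
    Admissible-∷ʳ⁺ a []            c f _              last = last , tt
    Admissible-∷ʳ⁺ a ((d , g) ∷ D) c f (head , rest) last =
      (λ g≡t → proj₁ (head g≡t) , subst (k ∣_) (sym (length-∷ʳ-+ D (c , f) a)) (proj₂ (head g≡t))) ,
      Admissible-∷ʳ⁺ a D c f rest last

    HeadAbove : Part → OverPtn → Set
    HeadAbove p []      = ⊤
    HeadAbove p (q ∷ _) = val q ≤ val p × (over p ≡ true → val q < val p)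

    Lk : OverPtn → Set
    Lk []      = ⊤
    Lk (p ∷ π) = 0 < val p × HeadAbove p π × (over p ≡ true → k ∣ length π) × Lk π

    IsLkOverpartition-tail : ∀ p π → IsLkOverpartition k (p ∷ π) → IsLkOverpartition k π
    IsLkOverpartition-tail p π ((pos , ord , last) , lk) =
      ((λ i → pos (fsuc i)) ,
       (λ i j i<j → ord (fsuc i) (fsuc j) (s≤s i<j)) ,
       (λ i j i<j → last (fsuc i) (fsuc j) (s≤s i<j))) ,
      (λ i → lk (fsuc i))

    IsOverpartition⇒HeadAbove : ∀ p π → IsOverpartition (p ∷ π) → HeadAbove p π
    IsOverpartition⇒HeadAbove p []      _                = tt
    IsOverpartition⇒HeadAbove p (q ∷ π) (_ , ord , last) =
      q≤p , λ o → ℕ.≤∧≢⇒< q≤p (last fzero (fsuc fzero) (s≤s z≤n) o)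
      where
      q≤p = ord fzero (fsuc fzero) (s≤s z≤n)

    IsLkOverpartition⇒Lk : ∀ π → IsLkOverpartition k π → Lk π
    IsLkOverpartition⇒Lk []      _                = tt
    IsLkOverpartition⇒Lk (p ∷ π) isLk@(io , lk) =
      proj₁ io fzero , IsOverpartition⇒HeadAbove p π io , lk fzero ,
      IsLkOverpartition⇒Lk π (IsLkOverpartition-tail p π isLk)

    head-max : ∀ q π → IsOverpartition (q ∷ π) → ∀ j → val (lookup (q ∷ π) j) ≤ val q
    head-max q π _             fzero    = ℕ.≤-refl
    head-max q π (_ , ord , _) (fsuc j) = ord fzero (fsuc j) (s≤s z≤n)

    HeadAbove⇒≥ : ∀ p π → HeadAbove p π → IsOverpartition π → ∀ j → val (lookup π j) ≤ val p
    HeadAbove⇒≥ p (q ∷ π) (q≤p , _) io j = ℕ.≤-trans (head-max q π io j) q≤p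

    HeadAbove⇒> : ∀ p π → HeadAbove p π → IsOverpartition π → over p ≡ true → ∀ j → val (lookup π j) < val p
    HeadAbove⇒> p (q ∷ π) (_ , q<p) io o j = ℕ.≤-<-trans (head-max q π io j) (q<p o)

    Lk⇒IsLkOverpartition : ∀ π → Lk π → IsLkOverpartition k π
    Lk⇒IsLkOverpartition []      _ = ((λ ()) , (λ ()) , (λ ())) , (λ ())
    Lk⇒IsLkOverpartition (p ∷ π) (p>0 , headAbove , p∣ , lkπ) with Lk⇒IsLkOverpartition π lkπ
    ... | (pos , ord , last) , lk = (pos′ , ord′ , last′) , lk′
      where
      pos′ : ∀ i → 0 < val (lookup (p ∷ π) i)
      pos′ fzero    = p>0
      pos′ (fsuc i) = pos i
      ord′ : ∀ (i j : Fin (length (p ∷ π))) → i Fin.< j → val (lookup (p ∷ π) j) ≤ val (lookup (p ∷ π) i)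
      ord′ fzero    (fsuc j) _         = HeadAbove⇒≥ p π headAbove (pos , ord , last) j
      ord′ (fsuc i) (fsuc j) (s≤s i<j) = ord i j i<j
      last′ : ∀ (i j : Fin (length (p ∷ π))) → i Fin.< j → over (lookup (p ∷ π) i) ≡ true →
              ¬ (val (lookup (p ∷ π) j) ≡ val (lookup (p ∷ π) i))
      last′ fzero    (fsuc j) _         o = ℕ.<⇒≢ (HeadAbove⇒> p π headAbove (pos , ord , last) o j)
      last′ (fsuc i) (fsuc j) (s≤s i<j)   = last i j i<j
      lk′ : ∀ (i : Fin (length (p ∷ π))) → over (lookup (p ∷ π) i) ≡ true → k ∣ (length (p ∷ π) ∸ suc (toℕ i))
      lk′ fzero    = p∣
      lk′ (fsuc i) = lk i

    toParts-Lk : ∀ D → Admissible 0 D → 1 ≤ lastDiff D → Lk (toParts D)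
    toParts-Lk []            _              _      = tt
    toParts-Lk ((d , f) ∷ D) (head , rest) last>0 =
      ℕ.≤-trans last>0 (lastDiff≤total ((d , f) ∷ D)) ,
      headAbove D ,
      (λ f≡t → subst (k ∣_) (trans (ℕ.+-identityʳ _) (sym (length-toParts D))) (proj₂ (head f≡t))) ,
      tailLk D rest last>0
      where
      headAbove : ∀ D → HeadAbove (d + total D , f) (toParts D)
      headAbove []              = tt
      headAbove ((d′ , _) ∷ D′) = ℕ.m≤n+m _ d , λ f≡t → ℕ.+-monoˡ-≤ (d′ + total D′) (proj₁ (head f≡t))
      tailLk : ∀ D → Admissible 0 D → 1 ≤ lastDiff ((d , f) ∷ D) → Lk (toParts D)
      tailLk []      _ _      = tt
      tailLk (y ∷ D) a last>0 = toParts-Lk (y ∷ D) a last>0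

    headVal : OverPtn → ℕ
    headVal []      = 0
    headVal (q ∷ _) = val q

    fromParts : OverPtn → Diffs
    fromParts []      = []
    fromParts (p ∷ π) = (val p ∸ headVal π , over p) ∷ fromParts π

    length-fromParts : ∀ π → length (fromParts π) ≡ length π
    length-fromParts []      = refl
    length-fromParts (p ∷ π) = cong suc (length-fromParts π)

    HeadAbove⇒headVal≤ : ∀ p π → HeadAbove p π → headVal π ≤ val p
    HeadAbove⇒headVal≤ p []      _         = z≤n
    HeadAbove⇒headVal≤ p (q ∷ π) (q≤p , _) = q≤p

    total-fromParts : ∀ π → Lk π → total (fromParts π) ≡ headVal π
    total-fromParts []      _                  = refl
    total-fromParts (p ∷ π) (_ , hd , _ , lkπ) =
      trans (cong (λ x → (val p ∸ headVal π) + x) (total-fromParts π lkπ)) (ℕ.m∸n+n≡m (HeadAbove⇒headVal≤ p π hd))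

    toParts-fromParts : ∀ π → Lk π → toParts (fromParts π) ≡ π
    toParts-fromParts []      _                      = refl
    toParts-fromParts (p ∷ π) lk@(_ , _ , _ , lkπ) =
      cong₂ _∷_ (cong (_, over p) (total-fromParts (p ∷ π) lk)) (toParts-fromParts π lkπ)

    fromParts-Admissible : ∀ π → Lk π → Admissible 0 (fromParts π)
    fromParts-Admissible []      _                      = tt
    fromParts-Admissible (p ∷ π) (p>0 , hd , p∣ , lkπ) =
      (λ o → ℕ.m<n⇒0<n∸m (headVal< π hd o) ,
             subst (k ∣_) (sym (trans (ℕ.+-identityʳ _) (length-fromParts π))) (p∣ o)) ,
      fromParts-Admissible π lkπ
      where
      headVal< : ∀ π → HeadAbove p π → over p ≡ true → headVal π < val p
      headVal< []      _         _ = p>0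
      headVal< (q ∷ π) (_ , q<p) o = q<p o

    fromParts-lastDiff : ∀ p π → Lk (p ∷ π) → 1 ≤ lastDiff (fromParts (p ∷ π))
    fromParts-lastDiff p []      (p>0 , _)          = p>0
    fromParts-lastDiff p (q ∷ π) (_ , _ , _ , lkπ) = fromParts-lastDiff q π lkπ

open DifferenceLists

module IndexedLists {A : Set} where

  open import Data.Nat as ℕ using (ℕ; zero; suc; _<_)
  import Data.Nat.Properties as ℕ
  open import Data.Integer as ℤ using (ℤ; +_)
  import Data.Integer.Properties as ℤ
  open import Data.Bool using (Bool; true; false; if_then_else_; T)
  open import Data.Sum using (inj₁; inj₂)
  open import Data.Product using (∃; _×_; _,_)
  open import Data.List using (List; []; _∷_; [_]; length; _++_)
  import Data.List.Properties as List
  open import Data.List.Membership.Propositional using (_∈_)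
  open import Data.List.Membership.Propositional.Properties using (∈-++⁺ˡ; ∈-++⁺ʳ; ∈-++⁻)
  open import Data.List.Relation.Unary.Unique.Propositional using (Unique)
  import Data.List.Relation.Unary.Unique.Propositional.Properties as Unique
  open import Data.List.Relation.Unary.AllPairs using ([]; _∷_)
  open import Data.List.Relation.Unary.All using ([])
  open import Relation.Nullary using (¬_)
  open import Relation.Binary.PropositionalEquality using (_≡_; refl; sym; trans; cong)

  concatUpTo : ℕ → (ℕ → List A) → List A
  concatUpTo zero    F = []
  concatUpTo (suc N) F = concatUpTo N F ++ F N

  ∈-concatUpTo⁺ : ∀ {x} N F {i} → i < N → x ∈ F i → x ∈ concatUpTo N F
  ∈-concatUpTo⁺ (suc N) F i<1+N x∈ with ℕ.m≤n⇒m<n∨m≡n (ℕ.≤-pred i<1+N)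
  ... | inj₁ i<N = ∈-++⁺ˡ (∈-concatUpTo⁺ N F i<N x∈)
  ... | inj₂ refl = ∈-++⁺ʳ (concatUpTo N F) x∈

  ∈-concatUpTo⁻ : ∀ {x} N F → x ∈ concatUpTo N F → ∃ λ i → i < N × x ∈ F i
  ∈-concatUpTo⁻ (suc N) F x∈ with ∈-++⁻ (concatUpTo N F) x∈
  ... | inj₂ x∈F = N , ℕ.≤-refl , x∈F
  ... | inj₁ x∈C with ∈-concatUpTo⁻ N F x∈C
  ...   | i , i<N , x∈F = i , ℕ.m<n⇒m<1+n i<N , x∈F

  concatUpTo-unique : ∀ N F → (∀ i → Unique (F i)) →
                      (∀ {x i j} → i < N → j < N → x ∈ F i → x ∈ F j → i ≡ j) → Unique (concatUpTo N F)
  concatUpTo-unique zero    F _ _ = []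
  concatUpTo-unique (suc N) F unique disjoint =
    Unique.++⁺ (concatUpTo-unique N F unique (λ i<N j<N → disjoint (ℕ.m<n⇒m<1+n i<N) (ℕ.m<n⇒m<1+n j<N)))
               (unique N) separate
    where
    separate : ∀ {x} → ¬ (x ∈ concatUpTo N F × x ∈ F N)
    separate (x∈C , x∈F) with ∈-concatUpTo⁻ N F x∈C
    ... | i , i<N , x∈Fi = ℕ.<⇒≢ i<N (disjoint (ℕ.m<n⇒m<1+n i<N) ℕ.≤-refl x∈Fi x∈F)

  length-concatUpTo : ∀ N F → + length (concatUpTo N F) ≡ sumℤ N (λ i → + length (F i))
  length-concatUpTo zero    F = refl
  length-concatUpTo (suc N) F = trans (cong +_ (List.length-++ (concatUpTo N F)))
                                      (cong (ℤ._+ + length (F N)) (length-concatUpTo N F))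

  keepIf : Bool → List A → List A
  keepIf b xs = if b then xs else []

  ∈-keepIf⁺ : ∀ {x} b {xs} → T b → x ∈ xs → x ∈ keepIf b xs
  ∈-keepIf⁺ true _ x∈ = x∈

  ∈-keepIf⁻ : ∀ {x} b {xs} → x ∈ keepIf b xs → T b × x ∈ xs
  ∈-keepIf⁻ true x∈ = _ , x∈

  keepIf-unique : ∀ b {xs} → Unique xs → Unique (keepIf b xs)
  keepIf-unique true  u = u
  keepIf-unique false _ = []

  length-keepIf : ∀ b xs → + length (keepIf b xs) ≡ + length xs ℤ.* ind b
  length-keepIf true  xs = sym (ℤ.*-identityʳ _)
  length-keepIf false xs = sym (ℤ.*-zeroʳ (+ length xs))

  [-]-unique : ∀ (x : A) → Unique [ x ]
  [-]-unique x = [] ∷ []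

open IndexedLists

module Enumeration (k : ℕ) where

  open import Data.Nat as ℕ using (zero; suc; _+_; _*_; _∸_; _≤_; _<_; _≡ᵇ_; z≤n; s≤s)
  import Data.Nat.Properties as ℕ
  open import Data.Nat.Divisibility using (_∣_; _∣?_; divides; ∣⇒≤)
  open import Data.Nat.DivMod using (_/_; m*[n/m]≡n; m*n/n≡m; m≥n⇒m/n>0)
  open import Data.Bool using (Bool; true; false; T; _∧_)
  open import Data.Product using (∃; _×_; _,_; proj₁; proj₂)
  open import Data.Sum using (inj₁; inj₂)
  open import Data.List using (List; []; _∷_; [_]; length; _∷ʳ_; _++_; map)
  open import Data.List.Membership.Propositional using (_∈_)
  open import Data.List.Membership.Propositional.Properties using (∈-map⁺; ∈-map⁻; ∈-++⁺ˡ; ∈-++⁺ʳ; ∈-++⁻)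
  open import Data.List.Relation.Unary.Unique.Propositional using (Unique)
  import Data.List.Relation.Unary.Unique.Propositional.Properties as Unique
  open import Data.List.Relation.Unary.Any using (here)
  open import Relation.Nullary using (¬_; contradiction)
  open import Relation.Nullary.Decidable using (⌊_⌋; toWitness; fromWitness)
  open import Data.List.Reverse using (reverseView; []; _∶_∶ʳ_)
  import Data.List.Properties as List
  open import Data.List.Relation.Unary.AllPairs using ([])
  open import Data.Bool.Properties using (T-∧)
  open import Function.Bundles using (Equivalence)
  open import Function using (_∘_)
  open import Data.Integer as ℤ using (+_)
  open import Relation.Binary.PropositionalEquality using (_≡_; refl; sym; trans; cong; cong₂; subst; subst₂; module ≡-Reasoning)

  positiveMultiple⁻ : ∀ {e r} → T (positiveMultiple e r) → 1 ≤ r × e ∣ r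
  positiveMultiple⁻ {r = suc r} ok = s≤s z≤n , toWitness ok

  positiveMultiple⁺ : ∀ {e r} → 1 ≤ r → e ∣ r → T (positiveMultiple e r)
  positiveMultiple⁺ {r = suc r} _ e∣r = fromWitness e∣r

  -- tab n t lists difference lists of weight n with t overlined entries
  Table : Set
  Table = ℕ → ℕ → List Diffs

  -- appending (c , f) to a list of length p adds r = (p + 1) c to its weight, so c = r / (p + 1)
  unflaggedOK : Bool → ℕ → ℕ → Bool
  unflaggedOK false e r = ⌊ e ∣? r ⌋
  unflaggedOK true  e r = positiveMultiple e r

  flaggedOK : ℕ → ℕ → ℕ → Bool
  flaggedOK a e r = ⌊ k ∣? a ⌋ ∧ positiveMultiple e r

  unflaggedOK⁻ : ∀ pos {e r} → T (unflaggedOK pos e r) → e ∣ r × (T pos → 1 ≤ r)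
  unflaggedOK⁻ false ok = toWitness ok , λ ()
  unflaggedOK⁻ true  ok = proj₂ (positiveMultiple⁻ ok) , λ _ → proj₁ (positiveMultiple⁻ ok)

  unflaggedOK⁺ : ∀ pos {e r} → e ∣ r → (T pos → 1 ≤ r) → T (unflaggedOK pos e r)
  unflaggedOK⁺ false e∣r _   = fromWitness e∣r
  unflaggedOK⁺ true  e∣r r>0 = positiveMultiple⁺ (r>0 _) e∣r

  flaggedOK⁻ : ∀ {a e r} → T (flaggedOK a e r) → k ∣ a × 1 ≤ r × e ∣ r
  flaggedOK⁻ {a} {e} {r} ok with Equivalence.to (T-∧ {⌊ k ∣? a ⌋} {positiveMultiple e r}) ok
  ... | k∣a , pm = toWitness k∣a , positiveMultiple⁻ pm

  flaggedOK⁺ : ∀ {a e r} → k ∣ a → 1 ≤ r → e ∣ r → T (flaggedOK a e r)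
  flaggedOK⁺ {a} {e} {r} k∣a r>0 e∣r =
    Equivalence.from (T-∧ {⌊ k ∣? a ⌋} {positiveMultiple e r}) (fromWitness k∣a , positiveMultiple⁺ r>0 e∣r)

  appendUnflagged : ℕ → Bool → Table → ℕ → ℕ → ℕ → List Diffs
  appendUnflagged p pos tab n t i =
    keepIf (unflaggedOK pos (suc p) (n ∸ i)) (map (_∷ʳ ((n ∸ i) / suc p , false)) (tab i t))

  appendFlagged : ℕ → ℕ → Table → ℕ → ℕ → ℕ → List Diffs
  appendFlagged a p tab n zero    i = []
  appendFlagged a p tab n (suc t) i =
    keepIf (flaggedOK a (suc p) (n ∸ i)) (map (_∷ʳ ((n ∸ i) / suc p , true)) (tab i t))

  extensions : ℕ → ℕ → Bool → Table → ℕ → ℕ → ℕ → List Diffs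
  extensions a p pos tab n t i = appendUnflagged p pos tab n t i ++ appendFlagged a p tab n t i

  extend : ℕ → ℕ → Bool → Table → Table
  extend a p pos tab n t = concatUpTo (suc n) (extensions a p pos tab n t)

  admissibleTable : ℕ → ℕ → Table
  admissibleTable a zero    n t = keepIf ((n ≡ᵇ 0) ∧ (t ≡ᵇ 0)) [ [] ]
  admissibleTable a (suc p)     = extend a p false (admissibleTable (suc a) p)

  lkTable : ℕ → Table
  lkTable p = extend 0 p true (admissibleTable 1 p)

  -- pos asks for a positive last difference, that is, a positive smallest part
  record Entry (a p : ℕ) (pos : Bool) (n t : ℕ) (D : Diffs) : Set where
    field
      length≡      : length D ≡ p
      admissible   : Admissible k a D
      weight≡      : weight D ≡ n
      overlines≡   : overlines D ≡ t
      lastPositive : T pos → 1 ≤ lastDiff D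

  record Enumerates (a p : ℕ) (pos : Bool) (tab : Table) : Set where
    field
      sound    : ∀ {n t D} → D ∈ tab n t → Entry a p pos n t D
      complete : ∀ {n t D} → Entry a p pos n t D → D ∈ tab n t
      unique   : ∀ n t → Unique (tab n t)

  data Extension (a p : ℕ) (pos : Bool) (tab : Table) (n : ℕ) : ℕ → ℕ → Diffs → Set where
    unflagged : ∀ {i t D} → T (unflaggedOK pos (suc p) (n ∸ i)) → D ∈ tab i t →
                Extension a p pos tab n t i (D ∷ʳ ((n ∸ i) / suc p , false))
    flagged   : ∀ {i t D} → T (flaggedOK a (suc p) (n ∸ i)) → D ∈ tab i t →
                Extension a p pos tab n (suc t) i (D ∷ʳ ((n ∸ i) / suc p , true))

  module _ (a p : ℕ) (pos : Bool) (tab : Table) where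

    ∈-extensions⁻ : ∀ {n t i D} → D ∈ extensions a p pos tab n t i → Extension a p pos tab n t i D
    ∈-extensions⁻ {n} {t} {i} D∈ with ∈-++⁻ (appendUnflagged p pos tab n t i) D∈
    ... | inj₁ D∈U with ∈-keepIf⁻ (unflaggedOK pos (suc p) (n ∸ i)) D∈U
    ...   | ok , D∈map with ∈-map⁻ (_∷ʳ ((n ∸ i) / suc p , false)) D∈map
    ...     | _ , D′∈ , refl = unflagged ok D′∈
    ∈-extensions⁻ {n} {suc t} {i} D∈ | inj₂ D∈F with ∈-keepIf⁻ (flaggedOK a (suc p) (n ∸ i)) D∈F
    ...   | ok , D∈map with ∈-map⁻ (_∷ʳ ((n ∸ i) / suc p , true)) D∈map
    ...     | _ , D′∈ , refl = flagged ok D′∈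

    ∈-extensions⁺ : ∀ {n t i D} → Extension a p pos tab n t i D → D ∈ extensions a p pos tab n t i
    ∈-extensions⁺ {n} {t} {i} (unflagged ok D′∈) =
      ∈-++⁺ˡ (∈-keepIf⁺ (unflaggedOK pos (suc p) (n ∸ i)) ok (∈-map⁺ (_∷ʳ ((n ∸ i) / suc p , false)) D′∈))
    ∈-extensions⁺ {n} {suc t} {i} (flagged ok D′∈) =
      ∈-++⁺ʳ (appendUnflagged p pos tab n (suc t) i)
             (∈-keepIf⁺ (flaggedOK a (suc p) (n ∸ i)) ok (∈-map⁺ (_∷ʳ ((n ∸ i) / suc p , true)) D′∈))

    entry-∷ʳ : ∀ {n t i D} f → Entry (suc a) p false i t D → i ≤ n → suc p ∣ (n ∸ i) →
               (f ≡ true → 1 ≤ n ∸ i × k ∣ a) → (T pos → 1 ≤ n ∸ i) →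
               Entry a (suc p) pos n (bit f + t) (D ∷ʳ ((n ∸ i) / suc p , f))
    entry-∷ʳ {n} {t} {i} {D} f e i≤n e∣r flagOK posOK = record
      { length≡      = trans (length-∷ʳ D (c , f)) (cong suc length≡)
      ; admissible   = Admissible-∷ʳ⁺ k a D c f admissible (λ f≡t → c>0 (proj₁ (flagOK f≡t)) , proj₂ (flagOK f≡t))
      ; weight≡      = begin
          weight (D ∷ʳ (c , f))     ≡⟨ weight-∷ʳ D c f ⟩
          weight D + suc (length D) * c ≡⟨ cong₂ (λ w ℓ → w + suc ℓ * c) weight≡ length≡ ⟩
          i + suc p * c             ≡⟨ cong (λ x → i + x) (m*[n/m]≡n e∣r) ⟩
          i + (n ∸ i)               ≡⟨ ℕ.m+[n∸m]≡n i≤n ⟩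
          n                         ∎
      ; overlines≡   = trans (overlines-∷ʳ D c f) (trans (ℕ.+-comm _ (bit f)) (cong (λ x → bit f + x) overlines≡))
      ; lastPositive = λ pos → subst (1 ≤_) (sym (lastDiff-∷ʳ D (c , f))) (c>0 (posOK pos))
      }
      where
      open Entry e
      open ≡-Reasoning
      c = (n ∸ i) / suc p
      c>0 : 1 ≤ n ∸ i → 1 ≤ c
      c>0 r>0 = m≥n⇒m/n>0 (∣⇒≤ ⦃ ℕ.>-nonZero r>0 ⦄ e∣r)

    extension-sound : (∀ {i t D} → D ∈ tab i t → Entry (suc a) p false i t D) →
                      ∀ {n t i D} → i ≤ n → Extension a p pos tab n t i D → Entry a (suc p) pos n t D
    extension-sound sound i≤n (unflagged ok D∈) with unflaggedOK⁻ pos ok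
    ... | e∣r , posOK = entry-∷ʳ false (sound D∈) i≤n e∣r (λ ()) posOK
    extension-sound sound i≤n (flagged ok D∈) with flaggedOK⁻ ok
    ... | k∣a , r>0 , e∣r = entry-∷ʳ true (sound D∈) i≤n e∣r (λ _ → r>0 , k∣a) (λ _ → r>0)

    module _ {n t D c f} (e : Entry a (suc p) pos n t (D ∷ʳ (c , f))) where

      open Entry e

      length-prefix : length D ≡ p
      length-prefix = ℕ.suc-injective (trans (sym (length-∷ʳ D (c , f))) length≡)

      weight-prefix+ : weight D + suc p * c ≡ n
      weight-prefix+ = trans (cong (λ ℓ → weight D + suc ℓ * c) (sym length-prefix))
                             (trans (sym (weight-∷ʳ D c f)) weight≡)

      weight-prefix≤ : weight D ≤ n
      weight-prefix≤ = subst (weight D ≤_) weight-prefix+ (ℕ.m≤m+n (weight D) _)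

      last-weight : n ∸ weight D ≡ c * suc p
      last-weight = trans (cong (_∸ weight D) (sym weight-prefix+))
                          (trans (ℕ.m+n∸m≡n (weight D) _) (ℕ.*-comm (suc p) c))

      last≡ : (n ∸ weight D) / suc p ≡ c
      last≡ = trans (cong (_/ suc p) last-weight) (m*n/n≡m c (suc p))

      last-positive : 1 ≤ c → 1 ≤ n ∸ weight D
      last-positive c>0 = subst (1 ≤_) (sym last-weight) (ℕ.≤-trans c>0 (ℕ.m≤m*n c (suc p)))

      prefix-entry : Entry (suc a) p false (weight D) (overlines D) D
      prefix-entry = record
        { length≡      = length-prefix
        ; admissible   = proj₁ (Admissible-∷ʳ⁻ k a D c f admissible)
        ; weight≡      = refl
        ; overlines≡   = refl
        ; lastPositive = λ ()
        }

      extension-complete : (∀ {i t D} → Entry (suc a) p false i t D → D ∈ tab i t) →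
                           Extension a p pos tab n t (weight D) (D ∷ʳ (c , f))
      extension-complete complete = subst₂ (λ t c → Extension a p pos tab n t (weight D) (D ∷ʳ (c , f)))
          (trans (ℕ.+-comm (bit f) (overlines D)) (trans (sym (overlines-∷ʳ D c f)) overlines≡)) last≡
          (extension f (proj₂ (Admissible-∷ʳ⁻ k a D c f admissible)))
        where
        e∣r : suc p ∣ n ∸ weight D
        e∣r = divides c last-weight
        posOK : T pos → 1 ≤ n ∸ weight D
        posOK p = last-positive (subst (1 ≤_) (lastDiff-∷ʳ D (c , f)) (lastPositive p))
        extension : ∀ f → (f ≡ true → 1 ≤ c × k ∣ a) →
                    Extension a p pos tab n (bit f + overlines D) (weight D) (D ∷ʳ ((n ∸ weight D) / suc p , f))
        extension false _       = unflagged (unflaggedOK⁺ pos e∣r posOK) (complete prefix-entry)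
        extension true  flagOK  = flagged (flaggedOK⁺ (proj₂ (flagOK refl)) (last-positive (proj₁ (flagOK refl))) e∣r)
                                          (complete prefix-entry)

    extension-prefix : (∀ {i t D} → D ∈ tab i t → Entry (suc a) p false i t D) →
                       ∀ {n t i D} → Extension a p pos tab n t i D → ∃ λ D′ → ∃ λ x → D ≡ D′ ∷ʳ x × weight D′ ≡ i
    extension-prefix sound (unflagged _ D′∈) = _ , _ , refl , Entry.weight≡ (sound D′∈)
    extension-prefix sound (flagged _ D′∈)   = _ , _ , refl , Entry.weight≡ (sound D′∈)

    extensions-unique : (∀ n t → Unique (tab n t)) → ∀ n t i → Unique (extensions a p pos tab n t i)
    extensions-unique unique n t i = Unique.++⁺ (keepIf-unique _ (append-unique (unique i t))) (flagged-unique t) (disjoint t)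
      where
      append-unique : ∀ {x xs} → Unique xs → Unique (map (_∷ʳ x) xs)
      append-unique = Unique.map⁺ (List.∷ʳ-injectiveˡ _ _)
      flagged-unique : ∀ t → Unique (appendFlagged a p tab n t i)
      flagged-unique zero    = []
      flagged-unique (suc t) = keepIf-unique _ (append-unique (unique i t))
      disjoint : ∀ t {D} → ¬ (D ∈ appendUnflagged p pos tab n t i × D ∈ appendFlagged a p tab n t i)
      disjoint (suc t) (D∈U , D∈F)
        with ∈-map⁻ (_∷ʳ ((n ∸ i) / suc p , false)) (proj₂ (∈-keepIf⁻ (unflaggedOK pos (suc p) (n ∸ i)) D∈U))
           | ∈-map⁻ (_∷ʳ ((n ∸ i) / suc p , true))  (proj₂ (∈-keepIf⁻ (flaggedOK a (suc p) (n ∸ i)) D∈F))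
      ... | D₁ , _ , eq₁ | D₂ , _ , eq₂ with cong proj₂ (List.∷ʳ-injectiveʳ D₁ D₂ (trans (sym eq₁) eq₂))
      ... | ()

    extend-enumerates : Enumerates (suc a) p false tab → Enumerates a (suc p) pos (extend a p pos tab)
    extend-enumerates E = record { sound = sound′ ; complete = complete′ ; unique = unique′ }
      where
      open Enumerates E
      sound′ : ∀ {n t D} → D ∈ extend a p pos tab n t → Entry a (suc p) pos n t D
      sound′ {n} {t} D∈ with ∈-concatUpTo⁻ (suc n) (extensions a p pos tab n t) D∈
      ... | i , i<1+n , D∈E = extension-sound sound (ℕ.≤-pred i<1+n) (∈-extensions⁻ D∈E)
      complete′ : ∀ {n t D} → Entry a (suc p) pos n t D → D ∈ extend a p pos tab n t
      complete′ {n} {t} {D} e with reverseView D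
      ... | []          = contradiction (Entry.length≡ e) (λ ())
      ... | D′ ∶ _ ∶ʳ x = ∈-concatUpTo⁺ (suc n) _ (s≤s (weight-prefix≤ e)) (∈-extensions⁺ (extension-complete e complete))
      unique′ : ∀ n t → Unique (extend a p pos tab n t)
      unique′ n t = concatUpTo-unique (suc n) _ (extensions-unique unique n t) same-index
        where
        same-index : ∀ {D i j} → i < suc n → j < suc n →
                     D ∈ extensions a p pos tab n t i → D ∈ extensions a p pos tab n t j → i ≡ j
        same-index _ _ D∈i D∈j with extension-prefix sound (∈-extensions⁻ D∈i) | extension-prefix sound (∈-extensions⁻ D∈j)
        ... | D₁ , _ , eq₁ , w₁ | D₂ , _ , eq₂ , w₂ =
          trans (sym w₁) (trans (cong weight (List.∷ʳ-injectiveˡ D₁ D₂ (trans (sym eq₁) eq₂))) w₂)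

  bothZero⁻ : ∀ {n t} → T ((n ≡ᵇ 0) ∧ (t ≡ᵇ 0)) → n ≡ 0 × t ≡ 0
  bothZero⁻ {zero} {zero} _ = refl , refl

  empty-enumerates : ∀ a → Enumerates a 0 false (admissibleTable a 0)
  empty-enumerates a = record
    { sound    = sound′
    ; complete = complete′
    ; unique   = λ n t → keepIf-unique ((n ≡ᵇ 0) ∧ (t ≡ᵇ 0)) ([-]-unique [])
    }
    where
    sound′ : ∀ {n t D} → D ∈ admissibleTable a 0 n t → Entry a 0 false n t D
    sound′ {n} {t} D∈ with ∈-keepIf⁻ ((n ≡ᵇ 0) ∧ (t ≡ᵇ 0)) D∈
    ... | ok , here refl with bothZero⁻ {n} {t} ok
    ... | refl , refl = record { length≡ = refl ; admissible = _ ; weight≡ = refl ; overlines≡ = refl ; lastPositive = λ () }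
    complete′ : ∀ {n t D} → Entry a 0 false n t D → D ∈ admissibleTable a 0 n t
    complete′ {D = []} record { weight≡ = refl ; overlines≡ = refl } = here refl
    complete′ {D = _ ∷ _} record { length≡ = () }

  admissibleTable-enumerates : ∀ p a → Enumerates a p false (admissibleTable a p)
  admissibleTable-enumerates zero    a = empty-enumerates a
  admissibleTable-enumerates (suc p) a =
    extend-enumerates a p false (admissibleTable (suc a) p) (admissibleTable-enumerates p (suc a))

  lkTable-enumerates : ∀ p → Enumerates 0 (suc p) true (lkTable p)
  lkTable-enumerates p = extend-enumerates 0 p true (admissibleTable 1 p) (admissibleTable-enumerates p 1)

  count : Table → ℕ → Series
  count tab t n = + length (tab n t)

  flaggedCount : ℕ → ℕ → Table → ℕ → Series
  flaggedCount a p tab zero    = zeroS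
  flaggedCount a p tab (suc t) = count tab t ⊛ (ind ∘ flaggedOK a (suc p))

  length-extend : ∀ a p pos tab t n →
    count (extend a p pos tab) t n ≡ (count tab t ⊛ (ind ∘ unflaggedOK pos (suc p))) n ℤ.+ flaggedCount a p tab t n
  length-extend a p pos tab t n = begin
    + length (concatUpTo (suc n) (extensions a p pos tab n t))
      ≡⟨ length-concatUpTo (suc n) (extensions a p pos tab n t) ⟩
    sumℤ (suc n) (λ i → + length (extensions a p pos tab n t i))
      ≡⟨ sumℤ-cong (suc n) (λ i _ → cong +_ (List.length-++ (appendUnflagged p pos tab n t i))) ⟩
    sumℤ (suc n) (λ i → + length (appendUnflagged p pos tab n t i) ℤ.+ + length (appendFlagged a p tab n t i))
      ≡⟨ sumℤ-+ (suc n) _ _ ⟩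
    sumℤ (suc n) (λ i → + length (appendUnflagged p pos tab n t i)) ℤ.+
    sumℤ (suc n) (λ i → + length (appendFlagged a p tab n t i))
      ≡⟨ cong₂ ℤ._+_ (sumℤ-cong (suc n) (λ i _ → length-append (unflaggedOK pos (suc p) (n ∸ i)) (tab i t)))
                     (flaggedSum t) ⟩
    (count tab t ⊛ (ind ∘ unflaggedOK pos (suc p))) n ℤ.+ flaggedCount a p tab t n ∎
    where
    open ≡-Reasoning
    length-append : ∀ b {x} xs → + length (keepIf b (map (_∷ʳ x) xs)) ≡ + length xs ℤ.* ind b
    length-append b {x} xs =
      trans (length-keepIf b (map (_∷ʳ x) xs)) (cong (λ ℓ → + ℓ ℤ.* ind b) (List.length-map (_∷ʳ x) xs))
    flaggedSum : ∀ t → sumℤ (suc n) (λ i → + length (appendFlagged a p tab n t i)) ≡ flaggedCount a p tab t n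
    flaggedSum zero    = sumℤ-zero (suc n) _ (λ _ → refl)
    flaggedSum (suc t) = sumℤ-cong (suc n) (λ i _ → length-append (flaggedOK a (suc p) (n ∸ i)) (tab i t))

module Positions (k′ s′ m′ : ℕ) (s≤K : suc s′ ≤ suc k′) where

  open import Data.Nat as ℕ using (zero; suc; _+_; _*_; _≤_; _<_; s≤s)
  import Data.Nat.Properties as ℕ
  import Data.Nat.Tactic.RingSolver as ℕ-Solver
  open import Data.Nat.Divisibility using (_∣_; ∣m+n∣m⇒∣n; ∣m∣n⇒∣m+n; ∣⇒≤; m∣m*n)
  open import Data.Product using (∃; _×_; _,_)
  open import Data.Sum using (inj₁; inj₂)
  open import Relation.Nullary using (¬_; contradiction)
  open import Relation.Binary.PropositionalEquality using (_≡_; refl; sym; trans; cong; subst; module ≡-Reasoning)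
  open ≡-Reasoning

  K s ℓ : ℕ
  K = suc k′
  s = suc s′
  ℓ = K * m′ + s

  no-positions : ∀ {y M} → y ≤ K → y ≡ s + K * M → M ≡ 0
  no-positions {M = zero}  _   _  = refl
  no-positions {M = suc M} y≤K y≡ = contradiction (subst (_≤ K) y≡ y≤K) (ℕ.<⇒≱ K<s+K[1+M])
    where
    K<s+K[1+M] : K < s + K * suc M
    K<s+K[1+M] = s≤s (ℕ.≤-trans (ℕ.m≤m*n K (suc M)) (ℕ.m≤n+m (K * suc M) s′))

  residue : ∀ {a p y M} → a + suc p ≡ ℓ → suc p + y ≡ s + K * M → a + K * M ≡ K * m′ + y
  residue {a} {p} {y} {M} a+p≡ p+y≡ = ℕ.+-cancelʳ-≡ s (a + K * M) (K * m′ + y) (begin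
    a + K * M + s     ≡⟨ ℕ.+-assoc a (K * M) s ⟩
    a + (K * M + s)   ≡⟨ cong (λ x → a + x) (ℕ.+-comm (K * M) s) ⟩
    a + (s + K * M)   ≡⟨ cong (λ x → a + x) p+y≡ ⟨
    a + (suc p + y)   ≡⟨ ℕ.+-assoc a (suc p) y ⟨
    a + suc p + y     ≡⟨ cong (_+ y) a+p≡ ⟩
    K * m′ + s + y    ≡⟨ regroup (K * m′) s y ⟩
    K * m′ + y + s    ∎)
    where
    regroup : ∀ x s y → x + s + y ≡ x + y + s
    regroup = ℕ-Solver.solve-∀

  -- the new position is overlinable (K ∣ a) exactly when y = K
  y≡K : ∀ {a p y M} → K ∣ a → a + suc p ≡ ℓ → suc p + y ≡ s + K * M → 1 ≤ y → y ≤ K → y ≡ K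
  y≡K {a} {p} {y} {M} K∣a a+p≡ p+y≡ y>0 y≤K = ℕ.≤-antisym y≤K (∣⇒≤ ⦃ ℕ.>-nonZero y>0 ⦄ K∣y)
    where
    K∣y : K ∣ y
    K∣y = ∣m+n∣m⇒∣n (subst (K ∣_) (residue a+p≡ p+y≡) (∣m∣n⇒∣m+n K∣a (m∣m*n M))) (m∣m*n m′)

  y<K : ∀ {a p y M} → ¬ K ∣ a → a + suc p ≡ ℓ → suc p + y ≡ s + K * M → y ≤ K → y < K
  y<K {a} {p} {y} {M} ¬K∣a a+p≡ p+y≡ y≤K with ℕ.m≤n⇒m<n∨m≡n y≤K
  ... | inj₁ lt   = lt
  ... | inj₂ refl = contradiction K∣a ¬K∣a
    where
    K∣a+KM : K ∣ a + K * M
    K∣a+KM = subst (K ∣_) (sym (trans (residue a+p≡ p+y≡) (cong (λ x → K * m′ + x) (sym (ℕ.*-identityʳ K)))))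
                   (∣m∣n⇒∣m+n (m∣m*n m′) (m∣m*n 1))
    K∣a : K ∣ a
    K∣a = ∣m+n∣m⇒∣n (subst (K ∣_) (ℕ.+-comm a (K * M)) K∣a+KM) (m∣m*n M)

  flaggable-position : ∀ {a p y M} → K ∣ a → a + suc p ≡ ℓ → suc p + y ≡ s + K * M → 1 ≤ y → y ≤ K →
                       ∃ λ M₀ → M ≡ suc M₀ × suc p ≡ s + K * M₀
  flaggable-position {a} {p} {y} {zero} K∣a a+p≡ p+y≡ y>0 y≤K =
    contradiction (subst (_≤ K) (sym (trans p+K≡ (trans (cong (λ x → s + x) (ℕ.*-zeroʳ K)) (ℕ.+-identityʳ s)))) s≤K)
                  (ℕ.<⇒≱ (s≤s (ℕ.m≤n+m K p)))
    where
    p+K≡ : suc p + K ≡ s + K * 0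
    p+K≡ = subst (λ y → suc p + y ≡ s + K * 0) (y≡K K∣a a+p≡ p+y≡ y>0 y≤K) p+y≡
  flaggable-position {a} {p} {y} {suc M₀} K∣a a+p≡ p+y≡ y>0 y≤K =
    M₀ , refl , ℕ.+-cancelʳ-≡ K (suc p) (s + K * M₀) (begin
      suc p + K           ≡⟨ cong (λ x → suc p + x) (y≡K K∣a a+p≡ p+y≡ y>0 y≤K) ⟨
      suc p + y           ≡⟨ p+y≡ ⟩
      s + K * suc M₀      ≡⟨ regroup s K M₀ ⟩
      s + K * M₀ + K      ∎)
    where
    regroup : ∀ s K M → s + K * suc M ≡ s + K * M + K
    regroup = ℕ-Solver.solve-∀

module GeneratingFunctions (k′ s′ m′ : ℕ) (s≤K : suc s′ ≤ suc k′) where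

  open import Data.Nat as ℕ using (zero; suc; _+_; _*_; _∸_; _≤_; _<_; _≡ᵇ_; z≤n; s≤s)
  import Data.Nat.Properties as ℕ
  open import Data.Nat.Divisibility using (_∣_; _∣?_; divides)
  open import Data.Integer as ℤ using (+_)
  import Data.Integer.Properties as ℤ
  open import Data.Bool using (true; false)
  open import Data.Product using (_,_)
  open import Data.Sum using ([_,_]′)
  open import Function using (_∘_)
  open import Relation.Nullary using (¬_; Dec; yes; no; contradiction)
  open import Relation.Binary.PropositionalEquality using (_≡_; refl; sym; trans; cong; cong₂; subst)
  open import Relation.Binary.Reasoning.Setoid ≈-setoid
  open ⊛-Solver using (solve; _⊜_) renaming (_⊕_ to _∙_)

  open Positions k′ s′ m′ s≤K

  open QBinomial k′ using (binomialTerm; binomialTerm-zero; binomialTerm-suc; binomialTerm->; exponent-suc; qBin->)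
  open import Data.Nat.Combinatorics using (_C_)
  open Enumeration K

  I : ℕ → Series
  I p = qPochInv 1 p

  I-suc : ∀ p → I p ⊛ geomInv (suc p) ≈ I (suc p)
  I-suc p = ⊛-congʳ (I p) (λ r → cong (λ e → geomInv e r) (sym (ℕ.*-identityˡ (suc p))))

  unflaggedOK-true : ∀ p → ind ∘ unflaggedOK true (suc p) ≈ qPow (suc p) ⊛ geomInv (suc p)
  unflaggedOK-true p = ≈-sym (qPow-⊛-geomInv p)

  flaggedOK-yes : ∀ {a} e → K ∣ a → ind ∘ flaggedOK a e ≈ ind ∘ positiveMultiple e
  flaggedOK-yes {a} e K∣a r with K ∣? a
  ... | yes _   = refl
  ... | no ¬K∣a = contradiction K∣a ¬K∣a

  flaggedOK-no : ∀ {a} e → ¬ K ∣ a → ind ∘ flaggedOK a e ≈ zeroS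
  flaggedOK-no {a} e ¬K∣a r with K ∣? a
  ... | yes K∣a = contradiction K∣a ¬K∣a
  ... | no _    = refl

  count-empty : ∀ a t → count (admissibleTable a 0) t ≈ I 0 ⊛ binomialTerm s 0 t
  count-empty a zero = begin
    count (admissibleTable a 0) 0   ≈⟨ (λ { zero → refl ; (suc n) → refl }) ⟩
    oneS                            ≈⟨ binomialTerm-zero s 0 ⟨
    binomialTerm s 0 0              ≈⟨ ⊛-identityˡ (binomialTerm s 0 0) ⟨
    I 0 ⊛ binomialTerm s 0 0        ∎
  count-empty a (suc t) = begin
    count (admissibleTable a 0) (suc t) ≈⟨ (λ { zero → refl ; (suc n) → refl }) ⟩
    zeroS                               ≈⟨ binomialTerm-> s (s≤s z≤n) ⟨
    binomialTerm s 0 (suc t)            ≈⟨ ⊛-identityˡ (binomialTerm s 0 (suc t)) ⟨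
    I 0 ⊛ binomialTerm s 0 (suc t)      ∎

  I-absorb : ∀ p X → (I p ⊛ X) ⊛ geomInv (suc p) ≈ I (suc p) ⊛ X
  I-absorb p X = begin
    (I p ⊛ X) ⊛ geomInv (suc p)   ≈⟨ solve 3 (λ i x g → (i ∙ x) ∙ g ⊜ (i ∙ g) ∙ x) (λ _ → refl) (I p) X (geomInv (suc p)) ⟩
    (I p ⊛ geomInv (suc p)) ⊛ X   ≈⟨ ⊛-congˡ X (I-suc p) ⟩
    I (suc p) ⊛ X                 ∎

  extend-unflaggable : ∀ {a p tab} (F : ℕ → Series) → ¬ K ∣ a → (∀ t → count tab t ≈ I p ⊛ F t) →
                       ∀ t → count (extend a p false tab) t ≈ I (suc p) ⊛ F t
  extend-unflaggable {a} {p} {tab} F ¬K∣a IH t = begin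
    count (extend a p false tab) t                             ≈⟨ length-extend a p false tab t ⟩
    (count tab t ⊛ geomInv (suc p)) ⊕ flaggedCount a p tab t   ≈⟨ ⊕-cong (⊛-congˡ (geomInv (suc p)) (IH t)) (no-flagged t) ⟩
    ((I p ⊛ F t) ⊛ geomInv (suc p)) ⊕ zeroS                    ≈⟨ ⊕-identityʳ _ ⟩
    (I p ⊛ F t) ⊛ geomInv (suc p)                              ≈⟨ I-absorb p (F t) ⟩
    I (suc p) ⊛ F t                                            ∎
    where
    no-flagged : ∀ t → flaggedCount a p tab t ≈ zeroS
    no-flagged zero    = ≈-refl {zeroS}
    no-flagged (suc t) = ≈-trans (⊛-congʳ (count tab t) (flaggedOK-no (suc p) ¬K∣a)) (⊛-zeroʳ (count tab t))

  extend-flaggable : ∀ {a p tab M} → K ∣ a → suc p ≡ s + K * M → (∀ t → count tab t ≈ I p ⊛ binomialTerm s M t) →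
                     ∀ t → count (extend a p false tab) t ≈ I (suc p) ⊛ binomialTerm s (suc M) t
  extend-flaggable {a} {p} {tab} {M} K∣a 1+p≡ IH zero = begin
    count (extend a p false tab) 0                  ≈⟨ length-extend a p false tab 0 ⟩
    (count tab 0 ⊛ geomInv (suc p)) ⊕ zeroS         ≈⟨ ⊕-identityʳ _ ⟩
    count tab 0 ⊛ geomInv (suc p)                   ≈⟨ ⊛-congˡ (geomInv (suc p)) (IH 0) ⟩
    (I p ⊛ binomialTerm s M 0) ⊛ geomInv (suc p)    ≈⟨ I-absorb p (binomialTerm s M 0) ⟩
    I (suc p) ⊛ binomialTerm s M 0
      ≈⟨ ⊛-congʳ (I (suc p)) (≈-trans (binomialTerm-zero s M) (≈-sym (binomialTerm-zero s (suc M)))) ⟩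
    I (suc p) ⊛ binomialTerm s (suc M) 0            ∎
  extend-flaggable {a} {p} {tab} {M} K∣a 1+p≡ IH (suc t) = begin
    count (extend a p false tab) (suc t)
      ≈⟨ length-extend a p false tab (suc t) ⟩
    (count tab (suc t) ⊛ geomInv (suc p)) ⊕ (count tab t ⊛ (ind ∘ flaggedOK a (suc p)))
      ≈⟨ ⊕-cong (⊛-congˡ (geomInv (suc p)) (IH (suc t))) (⊛-cong (IH t) flaggedSeries) ⟩
    ((I p ⊛ B (suc t)) ⊛ geomInv (suc p)) ⊕ ((I p ⊛ B t) ⊛ (qPow (suc p) ⊛ geomInv (suc p)))
      ≈⟨ ⊕-cong (I-absorb p (B (suc t))) shifted ⟩
    (I (suc p) ⊛ B (suc t)) ⊕ (I (suc p) ⊛ (qPow (s + K * M) ⊛ B t))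
      ≈⟨ ⊛-distribˡ-⊕ (I (suc p)) (B (suc t)) (qPow (s + K * M) ⊛ B t) ⟨
    I (suc p) ⊛ (B (suc t) ⊕ (qPow (s + K * M) ⊛ B t))
      ≈⟨ ⊛-congʳ (I (suc p)) (binomialTerm-suc s M t) ⟨
    I (suc p) ⊛ binomialTerm s (suc M) (suc t) ∎
    where
    B : ℕ → Series
    B = binomialTerm s M
    flaggedSeries : ind ∘ flaggedOK a (suc p) ≈ qPow (suc p) ⊛ geomInv (suc p)
    flaggedSeries = ≈-trans (flaggedOK-yes (suc p) K∣a) (≈-sym (qPow-⊛-geomInv p))
    shifted : (I p ⊛ B t) ⊛ (qPow (suc p) ⊛ geomInv (suc p)) ≈ I (suc p) ⊛ (qPow (s + K * M) ⊛ B t)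
    shifted = begin
      (I p ⊛ B t) ⊛ (qPow (suc p) ⊛ geomInv (suc p))
        ≈⟨ solve 4 (λ i b q g → (i ∙ b) ∙ (q ∙ g) ⊜ (i ∙ (q ∙ b)) ∙ g) (λ _ → refl)
                   (I p) (B t) (qPow (suc p)) (geomInv (suc p)) ⟩
      (I p ⊛ (qPow (suc p) ⊛ B t)) ⊛ geomInv (suc p)
        ≈⟨ I-absorb p (qPow (suc p) ⊛ B t) ⟩
      I (suc p) ⊛ (qPow (suc p) ⊛ B t)
        ≡⟨ cong (λ e → I (suc p) ⊛ (qPow e ⊛ B t)) 1+p≡ ⟩
      I (suc p) ⊛ (qPow (s + K * M) ⊛ B t) ∎

  -- Position j ≤ p may be overlined iff j ≡ s (mod K); p + y = s + K M with 1 ≤ y ≤ K says there are M of them.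
  admissibleTable-gf : ∀ p {a M y} → a + p ≡ ℓ → p + y ≡ s + K * M → 1 ≤ y → y ≤ K →
                       ∀ t → count (admissibleTable a p) t ≈ I p ⊛ binomialTerm s M t
  admissibleTable-gf zero {a} _ p+y≡ _ y≤K =
    subst (λ M → ∀ t → count (admissibleTable a 0) t ≈ I 0 ⊛ binomialTerm s M t)
          (sym (no-positions y≤K p+y≡)) (count-empty a)
  admissibleTable-gf (suc p) {a} {M} {y} a+p≡ p+y≡ y>0 y≤K = byDivisibility (K ∣? a)
    where
    IH : ∀ {M y} → p + y ≡ s + K * M → 1 ≤ y → y ≤ K →
         ∀ t → count (admissibleTable (suc a) p) t ≈ I p ⊛ binomialTerm s M t
    IH = admissibleTable-gf p (trans (sym (ℕ.+-suc a p)) a+p≡)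
    byDivisibility : Dec (K ∣ a) → ∀ t → count (admissibleTable a (suc p)) t ≈ I (suc p) ⊛ binomialTerm s M t
    byDivisibility (yes K∣a) =
      let M₀ , M≡ , 1+p≡ = flaggable-position K∣a a+p≡ p+y≡ y>0 y≤K in
      subst (λ M → ∀ t → count (admissibleTable a (suc p)) t ≈ I (suc p) ⊛ binomialTerm s M t) (sym M≡)
            (extend-flaggable K∣a 1+p≡ (IH (trans (ℕ.+-comm p 1) 1+p≡) (s≤s z≤n) (s≤s z≤n)))
    byDivisibility (no ¬K∣a) =
      extend-unflaggable (binomialTerm s M) ¬K∣a (IH (trans (ℕ.+-suc p y) p+y≡) (s≤s z≤n) (y<K ¬K∣a a+p≡ p+y≡ y≤K))

  -- the (s, m′ + 1, j + 1) term of the right-hand side, without its factor z^j + z^(j+1)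
  summand : ℕ → Series
  summand j = qPow ℓ ⊛ (I ℓ ⊛ binomialTerm s m′ j)

  summandBelow : ℕ → Series
  summandBelow zero    = zeroS
  summandBelow (suc j) = summand j

  summand-> : ∀ {j} → m′ < j → summand j ≈ zeroS
  summand-> {j} m′<j = begin
    qPow ℓ ⊛ (I ℓ ⊛ binomialTerm s m′ j)  ≈⟨ ⊛-congʳ (qPow ℓ) (⊛-congʳ (I ℓ) (binomialTerm-> s m′<j)) ⟩
    qPow ℓ ⊛ (I ℓ ⊛ zeroS)                ≈⟨ ⊛-congʳ (qPow ℓ) (⊛-zeroʳ (I ℓ)) ⟩
    qPow ℓ ⊛ zeroS                        ≈⟨ ⊛-zeroʳ (qPow ℓ) ⟩
    zeroS                                 ∎

  -- the last entry is positive and may be overlined, as K ∣ ℓ − ℓ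
  lkTable-gf : ∀ p → suc p ≡ ℓ → ∀ t → count (lkTable p) t ≈ summand t ⊕ summandBelow t
  lkTable-gf p 1+p≡ℓ t = begin
    count (lkTable p) t
      ≈⟨ length-extend 0 p true U t ⟩
    (count U t ⊛ (ind ∘ unflaggedOK true (suc p))) ⊕ flaggedCount 0 p U t
      ≈⟨ ⊕-cong (≈-trans (⊛-congʳ (count U t) (unflaggedOK-true p)) (last-entry t)) (flaggedCount-summand t) ⟩
    summand t ⊕ summandBelow t ∎
    where
    U = admissibleTable 1 p
    p+1≡ : p + 1 ≡ s + K * m′
    p+1≡ = trans (ℕ.+-comm p 1) (trans 1+p≡ℓ (ℕ.+-comm (K * m′) s))
    last-entry : ∀ t → count U t ⊛ (qPow (suc p) ⊛ geomInv (suc p)) ≈ summand t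
    last-entry t = begin
      count U t ⊛ (qPow (suc p) ⊛ geomInv (suc p))
        ≈⟨ ⊛-congˡ (qPow (suc p) ⊛ geomInv (suc p)) (admissibleTable-gf p 1+p≡ℓ p+1≡ (s≤s z≤n) (s≤s z≤n) t) ⟩
      (I p ⊛ binomialTerm s m′ t) ⊛ (qPow (suc p) ⊛ geomInv (suc p))
        ≈⟨ solve 4 (λ i b q g → (i ∙ b) ∙ (q ∙ g) ⊜ q ∙ ((i ∙ b) ∙ g)) (λ _ → refl)
                   (I p) (binomialTerm s m′ t) (qPow (suc p)) (geomInv (suc p)) ⟩
      qPow (suc p) ⊛ ((I p ⊛ binomialTerm s m′ t) ⊛ geomInv (suc p))
        ≈⟨ ⊛-congʳ (qPow (suc p)) (I-absorb p (binomialTerm s m′ t)) ⟩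
      qPow (suc p) ⊛ (I (suc p) ⊛ binomialTerm s m′ t)
        ≡⟨ cong (λ L → qPow L ⊛ (I L ⊛ binomialTerm s m′ t)) 1+p≡ℓ ⟩
      summand t ∎
    flaggedCount-summand : ∀ t → flaggedCount 0 p U t ≈ summandBelow t
    flaggedCount-summand zero    = ≈-refl {zeroS}
    flaggedCount-summand (suc t) =
      ≈-trans (⊛-congʳ (count U t) (≈-trans (flaggedOK-yes (suc p) (divides 0 refl)) (≈-sym (qPow-⊛-geomInv p)))) (last-entry t)

  rhsTerm-summand-≤ : ∀ {j} → j ≤ m′ → rhsTerm K s (suc m′) (suc j) ≈ summand j
  rhsTerm-summand-≤ {j} j≤m′ = begin
    (qPow (K * (suc j C 2) + s * suc j + K * (m′ ∸ j)) ⊛ I ℓ) ⊛ qBin K m′ j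
      ≡⟨ cong (λ e → (qPow e ⊛ I ℓ) ⊛ qBin K m′ j) (trans (exponent-suc s j≤m′) (cong (_+ e₀) (ℕ.+-comm s (K * m′)))) ⟩
    (qPow (ℓ + e₀) ⊛ I ℓ) ⊛ qBin K m′ j
      ≈⟨ ⊛-congˡ (qBin K m′ j) (⊛-congˡ (I ℓ) (qPow-+ ℓ e₀)) ⟩
    ((qPow ℓ ⊛ qPow e₀) ⊛ I ℓ) ⊛ qBin K m′ j
      ≈⟨ solve 4 (λ a b i B → ((a ∙ b) ∙ i) ∙ B ⊜ a ∙ (i ∙ (b ∙ B))) (λ _ → refl)
                 (qPow ℓ) (qPow e₀) (I ℓ) (qBin K m′ j) ⟩
    summand j ∎
    where
    e₀ = K * (j C 2) + s * j
  rhsTerm-summand-> : ∀ {j} → m′ < j → rhsTerm K s (suc m′) (suc j) ≈ summand j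
  rhsTerm-summand-> {j} m′<j = begin
    (qPow (K * (suc j C 2) + s * suc j + K * (m′ ∸ j)) ⊛ I ℓ) ⊛ qBin K m′ j
      ≡⟨ cong ((qPow (K * (suc j C 2) + s * suc j + K * (m′ ∸ j)) ⊛ I ℓ) ⊛_) (qBin-> m′<j) ⟩
    (qPow (K * (suc j C 2) + s * suc j + K * (m′ ∸ j)) ⊛ I ℓ) ⊛ zeroS
      ≈⟨ ⊛-zeroʳ (qPow (K * (suc j C 2) + s * suc j + K * (m′ ∸ j)) ⊛ I ℓ) ⟩
    zeroS
      ≈⟨ summand-> m′<j ⟨
    summand j ∎

  rhsTerm-summand : ∀ j → rhsTerm K s (suc m′) (suc j) ≈ summand j
  rhsTerm-summand j = [ rhsTerm-summand-≤ , rhsTerm-summand-> ]′ (ℕ.≤-<-connex j m′)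

  rhs-inner-sum : ∀ t n → sumℤ (suc m′) (λ j → zCoeff (suc j) t ℤ.* rhsTerm K s (suc m′) (suc j) n) ≡
                          summand t n ℤ.+ summandBelow t n
  rhs-inner-sum t n =
    trans (sumℤ-cong (suc m′) (λ j _ → trans (cong (zCoeff (suc j) t ℤ.*_) (rhsTerm-summand j n))
                                             (ℤ.*-distribʳ-+ (summand j n) (ind (t ≡ᵇ j)) (ind (t ≡ᵇ suc j)))))
    (trans (sumℤ-+ (suc m′) (λ j → ind (t ≡ᵇ j) ℤ.* summand j n) (λ j → ind (t ≡ᵇ suc j) ℤ.* summand j n))
           (cong₂ ℤ._+_ (sumℤ-select (suc m′) t (λ j → summand j n) vanish) (shifted t)))
    where
    vanish : ∀ j → suc m′ ≤ j → summand j n ≡ + 0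
    vanish j m′<j = summand-> m′<j n
    shifted : ∀ t → sumℤ (suc m′) (λ j → ind (t ≡ᵇ suc j) ℤ.* summand j n) ≡ summandBelow t n
    shifted zero    = sumℤ-zero (suc m′) _ (λ j → ℤ.*-zeroˡ (summand j n))
    shifted (suc t) = sumℤ-select (suc m′) t (λ j → summand j n) vanish

module LkOverpartitionsOf (k′ n t : ℕ) where

  open import Data.Nat as ℕ using (suc; _+_; _*_; _≤_; _<_; _≡ᵇ_; z≤n)
  import Data.Nat.Properties as ℕ
  open import Data.Nat.DivMod using (_/_; _%_; m≡m%n+[m/n]*n; [m+kn]%n≡m%n; m%n<n; m<n⇒m%n≡m; m/n≤m)
  open import Data.Integer as ℤ using (+_)
  import Data.Integer.Properties as ℤ
  open import Data.Bool using (true; T; _∧_)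
  open import Data.Product using (∃; _×_; _,_; proj₁)
  open import Data.Sum using ([_,_]′)
  open import Data.List using (List; []; _∷_; [_]; length; lookup; _++_; map)
  import Data.List.Properties as List
  open import Data.List.Membership.Propositional using (_∈_)
  open import Data.List.Membership.Propositional.Properties using (∈-map⁺; ∈-map⁻; ∈-++⁺ˡ; ∈-++⁺ʳ; ∈-++⁻)
  open import Data.List.Relation.Unary.Unique.Propositional using (Unique)
  import Data.List.Relation.Unary.Unique.Propositional.Properties as Unique
  open import Data.List.Relation.Unary.Any using (here)
  open import Data.Fin using (Fin) renaming (zero to fzero; suc to fsuc)
  open import Relation.Nullary using (¬_)
  open import Relation.Binary.PropositionalEquality using (_≡_; refl; sym; trans; cong; cong₂; subst; subst₂)

  K : ℕ
  K = suc k′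

  open Enumeration K

  ofLength : ℕ → List OverPtn
  ofLength p = map toParts (lkTable p n t)

  -- a nonempty partition of n has length K m′ + s′ + 1 with s′ < K and m′ < n;
  -- s = s′ + 1 and m = m′ + 1 are the summation indices of the right-hand side
  nonempty : List OverPtn
  nonempty = concatUpTo K (λ s′ → concatUpTo n (λ m′ → ofLength (K * m′ + s′)))

  empty : List OverPtn
  empty = keepIf ((n ≡ᵇ 0) ∧ (t ≡ᵇ 0)) [ [] ]

  lkOverpartitions : List OverPtn
  lkOverpartitions = empty ++ nonempty

  ∈-ofLength⁻ : ∀ {p π} → π ∈ ofLength p → ∃ λ D → π ≡ toParts D × Entry 0 (suc p) true n t D
  ∈-ofLength⁻ {p} π∈ with ∈-map⁻ toParts π∈
  ... | D , D∈ , π≡ = D , π≡ , Enumerates.sound (lkTable-enumerates p) D∈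

  ∈-ofLength⇒length : ∀ {p π} → π ∈ ofLength p → length π ≡ suc p
  ∈-ofLength⇒length π∈ with ∈-ofLength⁻ π∈
  ... | D , refl , e = trans (length-toParts D) (Entry.length≡ e)

  ∈-nonempty⁻ : ∀ {π} → π ∈ nonempty → ∃ λ s′ → ∃ λ m′ → π ∈ ofLength (K * m′ + s′) × s′ < K
  ∈-nonempty⁻ π∈ with ∈-concatUpTo⁻ K _ π∈
  ... | s′ , s′<K , π∈′ with ∈-concatUpTo⁻ n _ π∈′
  ...   | m′ , _ , π∈″ = s′ , m′ , π∈″ , s′<K

  [K*m+s]%K≡s : ∀ {m s′} → s′ < K → (K * m + s′) % K ≡ s′
  [K*m+s]%K≡s {m} {s′} s′<K =
    trans (cong (_% K) (trans (ℕ.+-comm (K * m) s′) (cong (λ x → s′ + x) (ℕ.*-comm K m))))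
          (trans ([m+kn]%n≡m%n s′ m K) (m<n⇒m%n≡m s′<K))

  ∈-empty⁻ : ∀ {π} → π ∈ empty → π ≡ [] × n ≡ 0 × t ≡ 0
  ∈-empty⁻ π∈ with ∈-keepIf⁻ ((n ≡ᵇ 0) ∧ (t ≡ᵇ 0)) π∈
  ... | ok , here π≡[] = π≡[] , bothZero⁻ {n} {t} ok

  ofLength-unique : ∀ p → Unique (ofLength p)
  ofLength-unique p = Unique.map⁺ (toParts-injective _ _) (Enumerates.unique (lkTable-enumerates p) n t)

  ∈-ofLength-injective : ∀ {π p₁ p₂} → π ∈ ofLength p₁ → π ∈ ofLength p₂ → p₁ ≡ p₂
  ∈-ofLength-injective π∈₁ π∈₂ = ℕ.suc-injective (trans (sym (∈-ofLength⇒length π∈₁)) (∈-ofLength⇒length π∈₂))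

  same-residue : ∀ {π s₁ s₂} → s₁ < K → s₂ < K → π ∈ concatUpTo n (λ m′ → ofLength (K * m′ + s₁)) →
                 π ∈ concatUpTo n (λ m′ → ofLength (K * m′ + s₂)) → s₁ ≡ s₂
  same-residue s₁<K s₂<K π∈₁ π∈₂ with ∈-concatUpTo⁻ n _ π∈₁ | ∈-concatUpTo⁻ n _ π∈₂
  ... | m₁ , _ , π∈₁′ | m₂ , _ , π∈₂′ =
    trans (sym ([K*m+s]%K≡s {m₁} s₁<K)) (trans (cong (_% K) (∈-ofLength-injective π∈₁′ π∈₂′)) ([K*m+s]%K≡s {m₂} s₂<K))

  lkOverpartitions-unique : Unique lkOverpartitions
  lkOverpartitions-unique = Unique.++⁺ (keepIf-unique _ ([-]-unique [])) nonempty-unique empty∉nonempty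
    where
    empty∉nonempty : ∀ {π} → ¬ (π ∈ empty × π ∈ nonempty)
    empty∉nonempty (π∈E , π∈N) =
      let _ , _ , π∈ , _ = ∈-nonempty⁻ π∈N in
      ℕ.1+n≢0 (trans (sym (∈-ofLength⇒length π∈)) (cong length (proj₁ (∈-empty⁻ π∈E))))
    nonempty-unique : Unique nonempty
    nonempty-unique = concatUpTo-unique K _
      (λ s′ → concatUpTo-unique n _ (λ m′ → ofLength-unique (K * m′ + s′))
                (λ _ _ π∈₁ π∈₂ → ℕ.*-cancelˡ-≡ _ _ K (ℕ.+-cancelʳ-≡ s′ _ _ (∈-ofLength-injective π∈₁ π∈₂))))
      same-residue

  empty-sound : ∀ {π} → π ∈ empty → IsLkOverpartition K π × size π ≡ n × numOver π ≡ t
  empty-sound π∈ with ∈-empty⁻ π∈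
  ... | refl , n≡0 , t≡0 = Lk⇒IsLkOverpartition K [] _ , sym n≡0 , sym t≡0

  ofLength-sound : ∀ {p π} → π ∈ ofLength p → IsLkOverpartition K π × size π ≡ n × numOver π ≡ t
  ofLength-sound π∈ with ∈-ofLength⁻ π∈
  ... | D , refl , e = Lk⇒IsLkOverpartition K (toParts D) (toParts-Lk K D admissible (lastPositive _)) , weight≡ , overlines≡
    where open Entry e

  lkOverpartitions-sound : ∀ {π} → π ∈ lkOverpartitions → IsLkOverpartition K π × size π ≡ n × numOver π ≡ t
  lkOverpartitions-sound π∈ = [ empty-sound , nonempty-sound ]′ (∈-++⁻ empty π∈)
    where
    nonempty-sound : ∀ {π} → π ∈ nonempty → IsLkOverpartition K π × size π ≡ n × numOver π ≡ t
    nonempty-sound π∈N = let _ , _ , π∈ , _ = ∈-nonempty⁻ π∈N in ofLength-sound π∈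

  ∈-ofLength⁺ : ∀ {q π} → IsLkOverpartition K (q ∷ π) → size (q ∷ π) ≡ n → numOver (q ∷ π) ≡ t →
                q ∷ π ∈ ofLength (length π)
  ∈-ofLength⁺ {q} {π} isLk size≡ numOver≡ =
    subst (_∈ ofLength (length π)) parts≡ (∈-map⁺ toParts (Enumerates.complete (lkTable-enumerates (length π)) entry))
    where
    lk = IsLkOverpartition⇒Lk K (q ∷ π) isLk
    parts≡ : toParts (fromParts K (q ∷ π)) ≡ q ∷ π
    parts≡ = toParts-fromParts K (q ∷ π) lk
    entry : Entry 0 (suc (length π)) true n t (fromParts K (q ∷ π))
    entry = record
      { length≡      = length-fromParts K (q ∷ π)
      ; admissible   = fromParts-Admissible K (q ∷ π) lk
      ; weight≡      = trans (cong size parts≡) size≡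
      ; overlines≡   = trans (cong numOver parts≡) numOver≡
      ; lastPositive = λ _ → fromParts-lastDiff K q π lk
      }

  length≤size : ∀ π → (∀ (i : Fin (length π)) → 0 < val (lookup π i)) → length π ≤ size π
  length≤size []      _   = z≤n
  length≤size (p ∷ π) pos = ℕ.+-mono-≤ (pos fzero) (length≤size π (λ i → pos (fsuc i)))

  lkOverpartitions-complete : ∀ {π} → IsLkOverpartition K π × size π ≡ n × numOver π ≡ t → π ∈ lkOverpartitions
  lkOverpartitions-complete {[]} (_ , n≡0 , t≡0) =
    ∈-++⁺ˡ (∈-keepIf⁺ ((n ≡ᵇ 0) ∧ (t ≡ᵇ 0)) (subst₂ (λ n t → T ((n ≡ᵇ 0) ∧ (t ≡ᵇ 0))) n≡0 t≡0 _) (here refl))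
  lkOverpartitions-complete {q ∷ π} (isLk , size≡ , numOver≡) =
    ∈-++⁺ʳ empty (∈-concatUpTo⁺ K _ (m%n<n ℓ K) (∈-concatUpTo⁺ n _ m′<n
      (subst (λ p → q ∷ π ∈ ofLength p) ℓ≡ (∈-ofLength⁺ isLk size≡ numOver≡))))
    where
    ℓ = length π
    ℓ≡ : ℓ ≡ K * (ℓ / K) + ℓ % K
    ℓ≡ = trans (m≡m%n+[m/n]*n ℓ K) (trans (ℕ.+-comm (ℓ % K) _) (cong (_+ ℓ % K) (ℕ.*-comm (ℓ / K) K)))
    m′<n : ℓ / K < n
    m′<n = ℕ.≤-<-trans (m/n≤m ℓ K) (subst (ℓ <_) size≡ (length≤size (q ∷ π) (proj₁ (proj₁ isLk))))

  length-lkOverpartitions : + length lkOverpartitions ≡ rhsCoeff K n t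
  length-lkOverpartitions =
    trans (cong +_ (List.length-++ empty))
    (cong₂ ℤ._+_ (trans (length-keepIf ((n ≡ᵇ 0) ∧ (t ≡ᵇ 0)) [ [] ]) (ℤ.*-identityˡ _))
                 (trans (length-concatUpTo K _)
                 (sumℤ-cong K (λ s′ s′<K → trans (length-concatUpTo n _)
                                             (sumℤ-cong n (λ m′ _ → count-ofLength s′ m′ s′<K))))))
    where
    count-ofLength : ∀ s′ m′ → s′ < K → + length (ofLength (K * m′ + s′)) ≡
                     sumℤ (suc m′) (λ j → zCoeff (suc j) t ℤ.* rhsTerm K (suc s′) (suc m′) (suc j) n)
    count-ofLength s′ m′ s′<K =
      trans (cong +_ (List.length-map toParts (lkTable (K * m′ + s′) n t)))
      (trans (lkTable-gf (K * m′ + s′) (sym (ℕ.+-suc (K * m′) s′)) t n) (sym (rhs-inner-sum t n)))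
      where open GeneratingFunctions k′ s′ m′ s′<K

mainTheorem4 : (k : ℕ) → 1 ≤ k → (n t : ℕ) →
    Σ (List OverPtn) (λ xs →
    Unique xs ×
    (∀ (π : OverPtn) → (π ∈ xs) ⇔ (IsLkOverpartition k π × size π ≡ n × numOver π ≡ t)) ×
    (+ length xs ≡ rhsCoeff k n t))
mainTheorem4 (suc k′) _ n t =
  lkOverpartitions ,
  lkOverpartitions-unique ,
  (λ π → mk⇔ lkOverpartitions-sound lkOverpartitions-complete) ,
  length-lkOverpartitions
  where open LkOverpartitionsOf k′ n t
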